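{- Let $\mathcal{K}$ be a non-archimedean local field of characteristic $0$ with ring of integers $O$, normalized valuation $v$, and residue field of size $|O/v| \equiv 1 \bmod 4$. Let $\pi_v$ be a uniformizer and let $\epsilon_v$ be any non-square element of $O^\ast$. Let $a_1,a_2,a_3 \in O$, put $\alpha := a_1 - a_2$, $\beta := a_1 - a_3$, $\gamma := a_2 - a_3$, and let $E: y^2 = (x-a_1)(x-a_2)(x-a_3)$. Then, writing $\delta: E(\mathcal{K}) \to (\mathcal{K}^\ast/\mathcal{K}^{\ast 2})^2$ for the $2$-descent (Kummer) map: (i) if $v(\alpha) \equiv 1 \bmod 2$ while $\beta, \gamma$ are invertible squares modulo $v$, then $\delta(E(\mathcal{K})) = \langle (\pi_v,\pi_v), (\epsilon_v,\epsilon_v)\rangle$; (ii) if $v(\beta) \equiv 1 \bmod 2$ while $\alpha, \gamma$ are invertible squares modulo $v$, then $\delta(E(\mathcal{K})) = \langle (\pi_v,1), (\epsilon_v,1)\rangle$; (iii) if $v(\gamma) \equiv 1 \bmod 2$ while $\alpha, \beta$ are invertible squares modulo $v$, then $\delta(E(\mathcal{K})) = \langle (1,\pi_v), (1,\epsilon_v)\rangle$.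
   Context: The map $\delta$ is the connecting homomorphism $E(\mathcal{K}) \to H^1(G_{\mathcal{K}}, E[2])$ of the Kummer sequence $0 \to E[2] \to E \xrightarrow{2} E \to 0$, where $E[2]$ is identified with $\mathbb{F}_2^2$ via $P \mapsto ((P,P_1)_{\mathrm{Weil}}, (P,P_2)_{\mathrm{Weil}})$ with $P_1 = (a_1,0)$, $P_2 = (a_2,0)$, and $H^1(G_{\mathcal{K}},\mathbb{F}_2) \cong \mathcal{K}^\ast/\mathcal{K}^{\ast 2}$ by Kummer theory. Concretely, $\delta(x,y) = (x-a_1, x-a_2)$ modulo squares for $y \neq 0$, $\delta(P_1) = (\alpha\beta, \alpha)$, $\delta(P_2) = (-\alpha, -\alpha\gamma)$, and $\delta(O) = (1,1)$. The classes are written multiplicatively as pairs in $(\mathcal{K}^\ast/\mathcal{K}^{\ast 2})^2$. -}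

module Defs where

open import Level using (Level; _⊔_) renaming (suc to lsuc)
open import Algebra.Bundles using (CommutativeRing)
open import Data.Nat using (ℕ; zero; suc; _≤_)
open import Data.Integer as ℤ using (ℤ; +_; 0ℤ; 1ℤ)
open import Data.Fin using (Fin)
open import Data.Product using (Σ; ∃; _×_; _,_)
open import Data.Sum using (_⊎_)
open import Relation.Nullary using (¬_)
open import Relation.Binary.PropositionalEquality using (_≡_)

data ℤ∞ : Set where
  fin : ℤ → ℤ∞
  ∞   : ℤ∞

infix 4 _≤∞_
data _≤∞_ : ℤ∞ → ℤ∞ → Set where
  fin≤fin : ∀ {m n} → m ℤ.≤ n → fin m ≤∞ fin n
  _≤∞∞    : ∀ x → x ≤∞ ∞

infixl 6 _+∞_
_+∞_ : ℤ∞ → ℤ∞ → ℤ∞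
fin m +∞ fin n = fin (m ℤ.+ n)
fin _ +∞ ∞     = ∞
∞     +∞ _     = ∞

module RingOps {c ℓ} (R : CommutativeRing c ℓ) where
  open CommutativeRing R

  _·1 : ℕ → Carrier
  zero  ·1 = 0#
  suc n ·1 = 1# + (n ·1)

record NALocalField c ℓ : Set (lsuc (c ⊔ ℓ)) where
  field
    cring : CommutativeRing c ℓ
  open CommutativeRing cring public
  open RingOps cring public

  field
    1≉0     : 1# ≉ 0#
    inverse : ∀ x → x ≉ 0# → Σ Carrier λ y → x * y ≈ 1#
    char0   : ∀ n → (suc n ·1) ≉ 0#
    v         : Carrier → ℤ∞
    v-cong    : ∀ {x y} → x ≈ y → v x ≡ v y
    v-∞       : ∀ x → (v x ≡ ∞ → x ≈ 0#) × (x ≈ 0# → v x ≡ ∞)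
    v-mult    : ∀ x y → v (x * y) ≡ v x +∞ v y
    v-ultra   : ∀ x y k → fin k ≤∞ v x → fin k ≤∞ v y → fin k ≤∞ v (x + y)
    v-normal  : Σ Carrier λ t → v t ≡ fin 1ℤ
    complete  : (s : ℕ → Carrier) →
                (∀ N → Σ ℕ λ M → ∀ m n → M ≤ m → M ≤ n → fin N ≤∞ v (s m - s n)) →
                Σ Carrier λ L → ∀ N → Σ ℕ λ M → ∀ n → M ≤ n → fin N ≤∞ v (s n - L)
    -- finite residue field O/m of size q, given by a complete set of
    -- pairwise incongruent representatives in O
    q         : ℕ
    rep       : Fin q → Carrier
    rep-int   : ∀ i → fin 0ℤ ≤∞ v (rep i)
    rep-inj   : ∀ i j → fin 1ℤ ≤∞ v (rep i - rep j) → i ≡ j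
    rep-surj  : ∀ x → fin 0ℤ ≤∞ v x → Σ (Fin q) λ i → fin 1ℤ ≤∞ v (x - rep i)

module _ {c ℓ} (K : NALocalField c ℓ) where
  open NALocalField K

  Integral : Carrier → Set
  Integral x = fin 0ℤ ≤∞ v x

  Unit : Carrier → Set
  Unit x = v x ≡ fin 0ℤ

  IsSquare : Carrier → Set (c ⊔ ℓ)
  IsSquare x = Σ Carrier λ z → x ≈ z * z

  InvSquareModV : Carrier → Set c
  InvSquareModV x = Unit x × Σ Carrier λ z → Integral z × fin 1ℤ ≤∞ v (x - z * z)

  OddVal : Carrier → Set
  OddVal x = Σ ℤ λ m → v x ≡ fin (1ℤ ℤ.+ (+ 2) ℤ.* m)

  SqClassEq : Carrier → Carrier → Set (c ⊔ ℓ)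
  SqClassEq x y = x ≉ 0# × y ≉ 0# × IsSquare (x * y)

  Pair : Set c
  Pair = Carrier × Carrier

  _∼_ : Pair → Pair → Set (c ⊔ ℓ)
  (x₁ , x₂) ∼ (y₁ , y₂) = SqClassEq x₁ y₁ × SqClassEq x₂ y₂

  _⊙_ : Pair → Pair → Pair
  (x₁ , x₂) ⊙ (y₁ , y₂) = (x₁ * y₁ , x₂ * y₂)

  pow : Pair → Fin 2 → Pair
  pow g Fin.zero = (1# , 1#)
  pow g (Fin.suc _) = g

  InSpan : Pair → Pair → Pair → Set (c ⊔ ℓ)
  InSpan g h p = Σ (Fin 2) λ e → Σ (Fin 2) λ f → p ∼ (pow g e ⊙ pow h f)

  module Curve (a₁ a₂ a₃ : Carrier) where
    α β γ : Carrier
    α = a₁ - a₂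
    β = a₁ - a₃
    γ = a₂ - a₃

    data Point : Set (c ⊔ ℓ) where
      O      : Point
      affine : (x y : Carrier) → y * y ≈ (x - a₁) * (x - a₂) * (x - a₃) → Point

    -- the 2-descent map δ, as a relation "δ(P) = p" (the value p is
    -- an actual representative pair; classes are compared with _∼_)
    data δ : Point → Pair → Set (c ⊔ ℓ) where
      δ-O       : δ O (1# , 1#)
      δ-generic : ∀ x y e → x ≉ a₁ → x ≉ a₂ →
                  δ (affine x y e) (x - a₁ , x - a₂)
      δ-P₁      : ∀ x y e → x ≈ a₁ → δ (affine x y e) (α * β , α)
      δ-P₂      : ∀ x y e → x ≈ a₂ → δ (affine x y e) (- α , - α * γ)

    ImageIs : Pair → Pair → Set (c ⊔ ℓ)
    ImageIs g h =
      (∀ P p → δ P p → InSpan g h p) ×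
      (∀ p → InSpan g h p → Σ Point λ P → Σ Pair λ p' → δ P p' × p' ∼ p)

{-# OPTIONS --safe #-}
-- Since q is odd, 2 is a unit, so Hensel's lemma lifts unit squares mod 𝔪 to squares of K.
-- Counting residues (squaring is two-to-one on the q − 1 nonzero residues) shows that the
-- unit square classes are 1 and ε, and, as 4 ∣ q − 1, that −1 is a square; hence
-- K*/K*² = ⟨π, ε⟩. In each case let r, r′ be the two roots with v(r − r′) odd and f the third
-- root, so that r − f is a unit square. For every point, x − f and (x − r)(x − r′) are squares,
-- so δ(P) is determined by the class of x − r and lies in the stated copy of ⟨π, ε⟩.
-- Conversely O, the 2-torsion point at r, and the points x = r + (r − f)m, x = r + (r − r′)m
-- for units m ~ ε with m + 1, resp. m(m + 1), a square realise the classes 1, r − r′, ε and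
-- (r − r′)ε, which represent all of ⟨π, ε⟩.
module Submission where

open import Defs
open import Level using (_⊔_)
open import Algebra.Bundles using (CommutativeRing)
open import Algebra.Solver.Ring.AlmostCommutativeRing using (fromCommutativeRing; _-Raw-AlmostCommutative⟶_)
import Algebra.Solver.Ring
open import Data.Bool using (Bool; true; false)
open import Data.Empty using (⊥-elim)
open import Data.Fin as F using (Fin; zero; suc)
import Data.Fin.Properties as FinP
open import Data.Integer as ℤ using (ℤ; +_; -[1+_]; _⊖_; 0ℤ; 1ℤ; _%ℕ_; _/ℕ_)
open import Data.Integer.DivMod using (a≡a%ℕn+[a/ℕn]*n; n%ℕd<d)
import Data.Integer.Properties as ℤP
open import Data.Integer.Tactic.RingSolver using (solve-∀)
open import Data.Maybe using (Maybe; just; nothing)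
open import Data.Nat as ℕ using (ℕ; zero; suc; z≤n; s≤s; _≤_)
open import Data.Nat.DivMod using (_%_; _/_; m≡m%n+[m/n]*n; m*n%n≡0; [m+kn]%n≡m%n)
import Data.Nat.Properties as ℕP
open import Data.Nat.Tactic.RingSolver using () renaming (solve-∀ to ℕ-solve-∀)
open import Data.Product using (Σ; ∃; ∃₂; _×_; _,_; proj₁; proj₂)
open import Data.Sum using (_⊎_; inj₁; inj₂; [_,_]′)
import Data.Sum as Sum
open import Data.Unit using (⊤; tt)
open import Function using (_∘_)
open import Relation.Nullary using (Dec; yes; no; ¬_; ¬?; _×-dec_)
open import Relation.Unary using (Decidable)
open import Relation.Binary.PropositionalEquality as ≡ using (_≡_; _≢_)

even≢odd : ∀ a b → a ℕ.* 2 ≢ suc (b ℕ.* 2)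
even≢odd a b eq = ℕP.0≢1+n (≡.trans (≡.sym (m*n%n≡0 a 2)) (≡.trans (≡.cong (_% 2) eq) ([m+kn]%n≡m%n 1 b 2)))

count : ∀ {n} (P : Fin n → Set) → Decidable P → ℕ
count {zero}  P P? = 0
count {suc n} P P? with P? zero
... | yes _ = suc (count (P ∘ suc) (P? ∘ suc))
... | no  _ = count (P ∘ suc) (P? ∘ suc)

module _ {n : ℕ} where

  _∖_ : (Fin n → Set) → Fin n → Fin n → Set
  (P ∖ a) i = P i × i ≢ a

  _∖?_ : {P : Fin n → Set} → Decidable P → ∀ a → Decidable (P ∖ a)
  (P? ∖? a) i = P? i ×-dec ¬? (i F.≟ a)

count-cong : ∀ {n} {P Q : Fin n → Set} (P? : Decidable P) (Q? : Decidable Q) →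
             (∀ i → P i → Q i) → (∀ i → Q i → P i) → count P P? ≡ count Q Q?
count-cong {zero}  P? Q? to from = ≡.refl
count-cong {suc n} P? Q? to from with P? zero | Q? zero
... | yes _ | yes _ = ≡.cong suc (count-cong (P? ∘ suc) (Q? ∘ suc) (to ∘ suc) (from ∘ suc))
... | no  _ | no  _ = count-cong (P? ∘ suc) (Q? ∘ suc) (to ∘ suc) (from ∘ suc)
... | yes p | no ¬q = ⊥-elim (¬q (to zero p))
... | no ¬p | yes q = ⊥-elim (¬p (from zero q))

count-mono : ∀ {n} {P Q : Fin n → Set} (P? : Decidable P) (Q? : Decidable Q) →
             (∀ i → P i → Q i) → count P P? ≤ count Q Q?
count-mono {zero}  P? Q? to = z≤n
count-mono {suc n} P? Q? to with P? zero | Q? zero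
... | yes _ | yes _ = s≤s (count-mono (P? ∘ suc) (Q? ∘ suc) (to ∘ suc))
... | no  _ | no  _ = count-mono (P? ∘ suc) (Q? ∘ suc) (to ∘ suc)
... | yes p | no ¬q = ⊥-elim (¬q (to zero p))
... | no  _ | yes _ = ℕP.m≤n⇒m≤1+n (count-mono (P? ∘ suc) (Q? ∘ suc) (to ∘ suc))

count-none : ∀ {n} {P : Fin n → Set} (P? : Decidable P) → (∀ i → ¬ P i) → count P P? ≡ 0
count-none {zero}  P? none = ≡.refl
count-none {suc n} P? none with P? zero
... | yes p = ⊥-elim (none zero p)
... | no  _ = count-none (P? ∘ suc) (none ∘ suc)

count-all : ∀ {n} {P : Fin n → Set} (P? : Decidable P) → (∀ i → P i) → count P P? ≡ n
count-all {zero}  P? all = ≡.refl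
count-all {suc n} P? all with P? zero
... | yes _ = ≡.cong suc (count-all (P? ∘ suc) (all ∘ suc))
... | no ¬p = ⊥-elim (¬p (all zero))

count≡suc⇒∃ : ∀ {n} {P : Fin n → Set} (P? : Decidable P) {k} → count P P? ≡ suc k → ∃ P
count≡suc⇒∃ {suc n} P? eq with P? zero
... | yes p = zero , p
... | no  _ with count≡suc⇒∃ (P? ∘ suc) eq
...   | i , p = suc i , p

count-split : ∀ {n} {P Q : Fin n → Set} (P? : Decidable P) (Q? : Decidable Q) →
              count P P? ≡ count (λ i → P i × Q i) (λ i → P? i ×-dec Q? i)
                           ℕ.+ count (λ i → P i × ¬ Q i) (λ i → P? i ×-dec ¬? (Q? i))
count-split {zero}  P? Q? = ≡.refl
count-split {suc n} P? Q? with P? zero | Q? zero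
... | yes _ | yes _ = ≡.cong suc (count-split (P? ∘ suc) (Q? ∘ suc))
... | yes _ | no  _ = ≡.trans (≡.cong suc (count-split (P? ∘ suc) (Q? ∘ suc))) (≡.sym (ℕP.+-suc _ _))
... | no  _ | yes _ = count-split (P? ∘ suc) (Q? ∘ suc)
... | no  _ | no  _ = count-split (P? ∘ suc) (Q? ∘ suc)

count-∖-suc : ∀ {n} {P : Fin (suc n) → Set} (P? : Decidable P) a →
              count ((P ∘ suc) ∖ a) ((P? ∘ suc) ∖? a) ≡ count ((P ∖ suc a) ∘ suc) ((P? ∖? suc a) ∘ suc)
count-∖-suc P? a = count-cong ((P? ∘ suc) ∖? a) ((P? ∖? suc a) ∘ suc)
  (λ i (p , i≢a) → p , i≢a ∘ FinP.suc-injective) (λ i (p , i≢a) → p , i≢a ∘ ≡.cong suc)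

count-remove : ∀ {n} {P : Fin n → Set} (P? : Decidable P) {a} → P a →
               count P P? ≡ suc (count (P ∖ a) (P? ∖? a))
count-remove {suc n} P? {zero} pa with P? zero | (P? ∖? zero) zero
... | yes _ | no  _         = ≡.cong suc (count-cong (P? ∘ suc) _ (λ _ p → p , λ ()) (λ _ → proj₁))
... | yes _ | yes (_ , a≢a) = ⊥-elim (a≢a ≡.refl)
... | no ¬p | _             = ⊥-elim (¬p pa)
count-remove {suc n} P? {suc a} pa with P? zero | (P? ∖? suc a) zero
... | yes _ | yes _ = ≡.cong suc (≡.trans (count-remove (P? ∘ suc) pa) (≡.cong suc (count-∖-suc P? a)))
... | no  _ | no  _ = ≡.trans (count-remove (P? ∘ suc) pa) (≡.cong suc (count-∖-suc P? a))
... | yes p | no ¬q = ⊥-elim (¬q (p , λ ()))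
... | no ¬p | yes q = ⊥-elim (¬p (proj₁ q))

⊆∧count≤⇒⊇ : ∀ {n} {P Q : Fin n → Set} (P? : Decidable P) (Q? : Decidable Q) →
             (∀ i → P i → Q i) → count Q Q? ≤ count P P? → ∀ i → Q i → P i
⊆∧count≤⇒⊇ {P = P} {Q} P? Q? P⊆Q count≤ i qi with P? i
... | yes pi = pi
... | no ¬pi = ⊥-elim (ℕP.<-irrefl ≡.refl (begin-strict
  count P P?                  ≤⟨ count-mono P? (Q? ∖? i) (λ j pj → P⊆Q j pj , λ { ≡.refl → ¬pi pj }) ⟩
  count (Q ∖ i) (Q? ∖? i)     <⟨ ℕP.≤-reflexive (≡.sym (count-remove Q? qi)) ⟩
  count Q Q?                  ≤⟨ count≤ ⟩
  count P P?                  ∎))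
  where open ℕP.≤-Reasoning

record FreeInvolution {n} (A : Fin n → Set) : Set where
  field
    σ                : Fin n → Fin n
    σ-closed         : ∀ {a} → A a → A (σ a)
    σ-involutive     : ∀ {a} → A a → σ (σ a) ≡ a
    σ-fixedPointFree : ∀ {a} → A a → σ a ≢ a

  _∖orbit_ : Fin n → Fin n → Set
  _∖orbit_ a = (A ∖ a) ∖ σ a

  _∖?orbit_ : Decidable A → ∀ a → Decidable (_∖orbit_ a)
  A? ∖?orbit a = (A? ∖? a) ∖? σ a

  count-∖orbit : (A? : Decidable A) {a : Fin n} → A a → count A A? ≡ 2 ℕ.+ count (_∖orbit_ a) (A? ∖?orbit a)
  count-∖orbit A? pa = ≡.trans (count-remove A? pa)
    (≡.cong suc (count-remove (A? ∖? _) (σ-closed pa , σ-fixedPointFree pa)))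

  restrict : ∀ {a} → A a → FreeInvolution (_∖orbit_ a)
  restrict {a} pa = record
    { σ                = σ
    ; σ-closed         = λ ((px , x≢a) , x≢σa) →
        (σ-closed px , λ σx≡a → x≢σa (≡.trans (≡.sym (σ-involutive px)) (≡.cong σ σx≡a))) ,
        λ σx≡σa → x≢a (≡.trans (≡.sym (σ-involutive px)) (≡.trans (≡.cong σ σx≡σa) (σ-involutive pa)))
    ; σ-involutive     = σ-involutive ∘ proj₁ ∘ proj₁
    ; σ-fixedPointFree = σ-fixedPointFree ∘ proj₁ ∘ proj₁
    }

even-count : ∀ {n} {A : Fin n → Set} (A? : Decidable A) → FreeInvolution A → ∃ λ m → count A A? ≡ m ℕ.* 2
even-count A? ι = go _ A? ι ≡.refl
  where
  go : ∀ {n} k {A : Fin n → Set} (A? : Decidable A) → FreeInvolution A → count A A? ≡ k → ∃ λ m → k ≡ m ℕ.* 2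
  go zero          A? ι eq = 0 , ≡.refl
  go (suc k)       A? ι eq with count≡suc⇒∃ A? eq
  ... | a , pa with k | ≡.trans (≡.sym (FreeInvolution.count-∖orbit ι A? pa)) eq
  ...   | suc k′ | eq′ with go k′ _ (FreeInvolution.restrict ι pa) (ℕP.suc-injective (ℕP.suc-injective eq′))
  ...     | m , ≡.refl = suc m , ≡.refl

record DoubleCover {n} (A B : Fin n → Set) : Set where
  field
    involution : FreeInvolution A
  open FreeInvolution involution public
  field
    f        : Fin n → Fin n
    f-into   : ∀ {a} → A a → B (f a)
    f-onto   : ∀ {b} → B b → ∃ λ a → A a × f a ≡ b
    f-σ      : ∀ {a} → A a → f (σ a) ≡ f a
    f-fibres : ∀ {a a′} → A a → A a′ → f a′ ≡ f a → a′ ≡ a ⊎ a′ ≡ σ a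

  restrict-cover : ∀ {a} → A a → DoubleCover (_∖orbit_ a) (B ∖ f a)
  restrict-cover {a} pa = record
    { involution = restrict pa
    ; f        = f
    ; f-into   = λ ((px , x≢a) , x≢σa) → f-into px , [ x≢a , x≢σa ]′ ∘ f-fibres pa px
    ; f-onto   = λ {b} (pb , b≢fa) → let (x , px , fx≡b) = f-onto pb in
        x , ((px , λ x≡a → b≢fa (≡.trans (≡.sym fx≡b) (≡.cong f x≡a))) ,
             λ x≡σa → b≢fa (≡.trans (≡.sym fx≡b) (≡.trans (≡.cong f x≡σa) (f-σ pa)))) , fx≡b
    ; f-σ      = f-σ ∘ proj₁ ∘ proj₁
    ; f-fibres = λ p p′ → f-fibres (proj₁ (proj₁ p)) (proj₁ (proj₁ p′))
    }

count-double : ∀ {n} {A B : Fin n → Set} (A? : Decidable A) (B? : Decidable B) →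
               DoubleCover A B → count A A? ≡ count B B? ℕ.* 2
count-double A? B? cover = go _ A? B? cover ≡.refl
  where
  go : ∀ {n} k {A B : Fin n → Set} (A? : Decidable A) (B? : Decidable B) →
       DoubleCover A B → count B B? ≡ k → count A A? ≡ k ℕ.* 2
  go zero    A? B? cover eq = count-none A? λ a pa →
    ℕP.0≢1+n (≡.trans (≡.sym eq) (count-remove B? (DoubleCover.f-into cover pa)))
  go (suc k) A? B? cover eq with count≡suc⇒∃ B? eq
  ... | b , pb with DoubleCover.f-onto cover pb
  ...   | a , pa , ≡.refl = ≡.trans (DoubleCover.count-∖orbit cover A? pa)
    (≡.cong (2 ℕ.+_) (go k _ (B? ∖? _) (DoubleCover.restrict-cover cover pa)
      (ℕP.suc-injective (≡.trans (≡.sym (count-remove B? pb)) eq))))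

even-or-odd : ∀ k → (∃ λ m → k ≡ m ℤ.+ m) ⊎ (∃ λ m → k ≡ 1ℤ ℤ.+ + 2 ℤ.* m)
even-or-odd k with k %ℕ 2 | n%ℕd<d k 2 | a≡a%ℕn+[a/ℕn]*n k 2
... | 0 | _ | k≡2m   = inj₁ (k /ℕ 2 , ≡.trans k≡2m (even (k /ℕ 2)))
  where
  even : ∀ m → + 0 ℤ.+ m ℤ.* + 2 ≡ m ℤ.+ m
  even = solve-∀
... | 1 | _ | k≡2m+1 = inj₂ (k /ℕ 2 , ≡.trans k≡2m+1 (odd (k /ℕ 2)))
  where
  odd : ∀ m → + 1 ℤ.+ m ℤ.* + 2 ≡ 1ℤ ℤ.+ + 2 ℤ.* m
  odd = solve-∀
... | suc (suc _) | s≤s (s≤s ()) | _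

odd≢even : ∀ m k → 1ℤ ℤ.+ + 2 ℤ.* m ≢ k ℤ.+ k
odd≢even m k eq = even≢odd ℤ.∣ k ℤ.- m ∣ 0 (≡.sym (begin
  1                                     ≡⟨⟩
  ℤ.∣ 1ℤ ∣                              ≡⟨ ≡.cong ℤ.∣_∣ (1≡[1+2m]-2m m) ⟩
  ℤ.∣ (1ℤ ℤ.+ + 2 ℤ.* m) ℤ.- + 2 ℤ.* m ∣ ≡⟨ ≡.cong (λ n → ℤ.∣ n ℤ.- + 2 ℤ.* m ∣) eq ⟩
  ℤ.∣ (k ℤ.+ k) ℤ.- + 2 ℤ.* m ∣          ≡⟨ ≡.cong ℤ.∣_∣ (2k-2m≡[k-m]2 m k) ⟩
  ℤ.∣ (k ℤ.- m) ℤ.* + 2 ∣               ≡⟨ ℤP.abs-* (k ℤ.- m) (+ 2) ⟩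
  ℤ.∣ k ℤ.- m ∣ ℕ.* 2                   ∎))
  where
  open ≡.≡-Reasoning
  1≡[1+2m]-2m : ∀ m → 1ℤ ≡ (1ℤ ℤ.+ + 2 ℤ.* m) ℤ.- + 2 ℤ.* m
  1≡[1+2m]-2m = solve-∀
  2k-2m≡[k-m]2 : ∀ m k → (k ℤ.+ k) ℤ.- + 2 ℤ.* m ≡ (k ℤ.- m) ℤ.* + 2
  2k-2m≡[k-m]2 = solve-∀

module ℤ-Coefficients {c ℓ} (R : CommutativeRing c ℓ) where
  open CommutativeRing R
  open import Algebra.Properties.Semiring.Mult.TCOptimised semiring using (×-homo-+; ×1-homo-*) renaming (_×_ to _×ₙ_)
  open import Algebra.Properties.Ring ring using (-‿distribˡ-*; -‿distribʳ-*; -‿involutive; -0#≈0#; -‿anti-homo-+)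
  open import Relation.Binary.Reasoning.Setoid setoid

  fromℤ : ℤ → Carrier
  fromℤ (+ n)    = n ×ₙ 1#
  fromℤ -[1+ n ] = - (suc n ×ₙ 1#)

  fromℤ-⊖ : ∀ m n → fromℤ (m ⊖ n) ≈ m ×ₙ 1# - n ×ₙ 1#
  fromℤ-⊖ m       zero    = sym (trans (+-congˡ -0#≈0#) (+-identityʳ _))
  fromℤ-⊖ zero    (suc n) = sym (+-identityˡ _)
  fromℤ-⊖ (suc m) (suc n) = begin
    fromℤ (suc m ⊖ suc n)                        ≡⟨ ≡.cong fromℤ (ℤP.[1+m]⊖[1+n]≡m⊖n m n) ⟩
    fromℤ (m ⊖ n)                                ≈⟨ fromℤ-⊖ m n ⟩
    m ×ₙ 1# - n ×ₙ 1#                          ≈⟨ +-congˡ (-‿cong (+-identityˡ _)) ⟨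
    m ×ₙ 1# - (0# + n ×ₙ 1#)                   ≈⟨ +-congˡ (-‿cong (+-congʳ (-‿inverseˡ 1#))) ⟨
    m ×ₙ 1# - ((- 1# + 1#) + n ×ₙ 1#)          ≈⟨ +-congˡ (-‿cong (+-assoc _ _ _)) ⟩
    m ×ₙ 1# - (- 1# + (1# + n ×ₙ 1#))          ≈⟨ +-congˡ (-‿anti-homo-+ _ _) ⟩
    m ×ₙ 1# + (- (1# + n ×ₙ 1#) + - - 1#)      ≈⟨ +-congˡ (+-comm _ _) ⟩
    m ×ₙ 1# + (- - 1# + - (1# + n ×ₙ 1#))      ≈⟨ +-assoc _ _ _ ⟨
    (m ×ₙ 1# + - - 1#) + - (1# + n ×ₙ 1#)      ≈⟨ +-cong (trans (+-congˡ (-‿involutive 1#)) (+-comm _ _)) (-‿cong (sym (×-homo-+ 1# 1 n))) ⟩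
    (1# + m ×ₙ 1#) - suc n ×ₙ 1#               ≈⟨ +-congʳ (×-homo-+ 1# 1 m) ⟨
    suc m ×ₙ 1# - suc n ×ₙ 1#                  ∎

  fromℤ-+ : ∀ i j → fromℤ (i ℤ.+ j) ≈ fromℤ i + fromℤ j
  fromℤ-+ (+ m)    (+ n)    = ×-homo-+ 1# m n
  fromℤ-+ (+ m)    -[1+ n ] = fromℤ-⊖ m (suc n)
  fromℤ-+ -[1+ m ] (+ n)    = trans (fromℤ-⊖ n (suc m)) (+-comm _ _)
  fromℤ-+ -[1+ m ] -[1+ n ] = begin
    - (suc (suc (m ℕ.+ n)) ×ₙ 1#)          ≡⟨ ≡.cong (λ k → - (suc k ×ₙ 1#)) (ℕP.+-suc m n) ⟨
    - ((suc m ℕ.+ suc n) ×ₙ 1#)            ≈⟨ -‿cong (×-homo-+ 1# (suc m) (suc n)) ⟩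
    - (suc m ×ₙ 1# + suc n ×ₙ 1#)           ≈⟨ -‿anti-homo-+ _ _ ⟩
    - (suc n ×ₙ 1#) + - (suc m ×ₙ 1#)       ≈⟨ +-comm _ _ ⟩
    - (suc m ×ₙ 1#) + - (suc n ×ₙ 1#)       ∎

  fromℤ-neg : ∀ i → fromℤ (ℤ.- i) ≈ - fromℤ i
  fromℤ-neg (+ zero)  = sym -0#≈0#
  fromℤ-neg (+ suc n) = refl
  fromℤ-neg -[1+ n ]  = sym (-‿involutive _)

  fromℤ-* : ∀ i j → fromℤ (i ℤ.* j) ≈ fromℤ i * fromℤ j
  fromℤ-* (+ zero)  j        = sym (zeroˡ _)
  fromℤ-* i (+ zero) rewrite ℤP.*-zeroʳ i = sym (zeroʳ _)
  fromℤ-* (+ suc m) (+ suc n) = ×1-homo-* (suc m) (suc n)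
  fromℤ-* (+ suc m) -[1+ n ]  = trans (-‿cong (×1-homo-* (suc m) (suc n))) (-‿distribʳ-* _ _)
  fromℤ-* -[1+ m ]  (+ suc n) = trans (-‿cong (×1-homo-* (suc m) (suc n))) (-‿distribˡ-* _ _)
  fromℤ-* -[1+ m ]  -[1+ n ]  = begin
    (suc m ℕ.* suc n) ×ₙ 1#             ≈⟨ ×1-homo-* (suc m) (suc n) ⟩
    (suc m ×ₙ 1#) * (suc n ×ₙ 1#)        ≈⟨ -‿involutive _ ⟨
    - - ((suc m ×ₙ 1#) * (suc n ×ₙ 1#))  ≈⟨ -‿cong (-‿distribʳ-* _ _) ⟩
    - ((suc m ×ₙ 1#) * - (suc n ×ₙ 1#))  ≈⟨ -‿distribˡ-* _ _ ⟩
    - (suc m ×ₙ 1#) * - (suc n ×ₙ 1#)    ∎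

  homomorphism : ℤ.+-*-rawRing -Raw-AlmostCommutative⟶ fromCommutativeRing R
  homomorphism = record
    { ⟦_⟧ = fromℤ ; +-homo = fromℤ-+ ; *-homo = fromℤ-* ; -‿homo = fromℤ-neg ; 0-homo = refl ; 1-homo = refl }

  _≟-image_ : ∀ i j → Maybe (fromℤ i ≈ fromℤ j)
  i ≟-image j with i ℤ.≟ j
  ... | yes ≡.refl = just refl
  ... | no  _      = nothing

  open Algebra.Solver.Ring ℤ.+-*-rawRing (fromCommutativeRing R) homomorphism _≟-image_ public
    using (solve; _:=_; _:+_; _:*_; :-_; _:-_; con)

fin-injective : ∀ {m n} → fin m ≡ fin n → m ≡ n
fin-injective ≡.refl = ≡.refl

≤∞-trans : ∀ {x y z} → x ≤∞ y → y ≤∞ z → x ≤∞ z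
≤∞-trans (fin≤fin p) (fin≤fin q) = fin≤fin (ℤP.≤-trans p q)
≤∞-trans _           (_ ≤∞∞)     = _ ≤∞∞

+∞-identityˡ : ∀ x → fin 0ℤ +∞ x ≡ x
+∞-identityˡ (fin k) = ≡.cong fin (ℤP.+-identityˡ k)
+∞-identityˡ ∞       = ≡.refl

2*i≡i+i : ∀ i → + 2 ℤ.* i ≡ i ℤ.+ i
2*i≡i+i = solve-∀

i+i≡j+j⇒i≡j : ∀ {i j} → i ℤ.+ i ≡ j ℤ.+ j → i ≡ j
i+i≡j+j⇒i≡j {i} {j} eq = ℤP.*-cancelˡ-≡ (+ 2) i j (≡.trans (2*i≡i+i i) (≡.trans eq (≡.sym (2*i≡i+i j))))

j≡-i+[i+j] : ∀ i j → j ≡ ℤ.- i ℤ.+ (i ℤ.+ j)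
j≡-i+[i+j] = solve-∀

i+j≡0⇒j≡-i : ∀ {i j} → i ℤ.+ j ≡ 0ℤ → j ≡ ℤ.- i
i+j≡0⇒j≡-i {i} {j} eq = ≡.trans (j≡-i+[i+j] i j) (≡.trans (≡.cong (ℤ._+_ (ℤ.- i)) eq) (ℤP.+-identityʳ (ℤ.- i)))

i+i≡i⇒i≡0 : ∀ {i} → i ℤ.+ i ≡ i → i ≡ 0ℤ
i+i≡i⇒i≡0 {i} eq = ≡.trans (j≡-i+[i+j] i i) (≡.trans (≡.cong (ℤ._+_ (ℤ.- i)) eq) (ℤP.+-inverseˡ i))

i≤∣i∣ : ∀ i → i ℤ.≤ + ℤ.∣ i ∣
i≤∣i∣ (+ n)      = ℤP.≤-refl
i≤∣i∣ ℤ.-[1+ n ] = ℤ.-≤+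

module Valuation {c ℓ} (K : NALocalField c ℓ) where
  open NALocalField K
  open ℤ-Coefficients cring
  open import Algebra.Properties.Ring ring using (-0#≈0#)

  infix 4 _≤ᵛ_ _≤ᵛ?_ _≡𝔪_

  _≤ᵛ_ : ℤ → Carrier → Set
  k ≤ᵛ x = fin k ≤∞ v x

  _≡𝔪_ : Carrier → Carrier → Set
  x ≡𝔪 y = 1ℤ ≤ᵛ x - y

  x≈y⇒x-y≈0 : ∀ {x y} → x ≈ y → x - y ≈ 0#
  x≈y⇒x-y≈0 {y = y} x≈y = trans (+-congʳ x≈y) (-‿inverseʳ y)

  x-y≈0⇒x≈y : ∀ {x y} → x - y ≈ 0# → x ≈ y
  x-y≈0⇒x≈y {x} {y} x-y≈0 =
    trans (solve 2 (λ x y → x := (x :- y) :+ y) refl x y) (trans (+-congʳ x-y≈0) (+-identityˡ y))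

  ≉⇒-≉0 : ∀ {x y} → x ≉ y → x - y ≉ 0#
  ≉⇒-≉0 x≉y x-y≈0 = x≉y (x-y≈0⇒x≈y x-y≈0)

  neg-≉0 : ∀ {x} → x ≉ 0# → - x ≉ 0#
  neg-≉0 {x} x≉0 -x≈0 =
    x≉0 (trans (solve 1 (λ x → x := :- (:- x)) refl x) (trans (-‿cong -x≈0) (solve 0 (:- con (+ 0) := con (+ 0)) refl)))

  v-0 : v 0# ≡ ∞
  v-0 = proj₂ (v-∞ 0#) refl

  v≡fin⇒≉0 : ∀ {x k} → v x ≡ fin k → x ≉ 0#
  v≡fin⇒≉0 {x} vx≡k x≈0 with ≡.trans (≡.sym vx≡k) (proj₂ (v-∞ x) x≈0)
  ... | ()

  ≉0⇒v≡fin : ∀ {x} → x ≉ 0# → ∃ λ k → v x ≡ fin k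
  ≉0⇒v≡fin {x} x≉0 with v x in eq
  ... | fin k = k , ≡.refl
  ... | ∞     = ⊥-elim (x≉0 (proj₁ (v-∞ x) eq))

  v-* : ∀ {x y m n} → v x ≡ fin m → v y ≡ fin n → v (x * y) ≡ fin (m ℤ.+ n)
  v-* {x} {y} vx vy = ≡.trans (v-mult x y) (≡.cong₂ _+∞_ vx vy)

  *-≉0 : ∀ {x y} → x ≉ 0# → y ≉ 0# → x * y ≉ 0#
  *-≉0 x≉0 y≉0 = v≡fin⇒≉0 (v-* (proj₂ (≉0⇒v≡fin x≉0)) (proj₂ (≉0⇒v≡fin y≉0)))

  v-square-unit : ∀ {x k} → v (x * x) ≡ fin (k ℤ.+ k) → v x ≡ fin k
  v-square-unit {x} {k} vxx with v x in eq
  ... | ∞     = ⊥-elim (v≡fin⇒≉0 vxx (proj₁ (v-∞ (x * x)) (≡.trans (v-mult x x) (≡.cong (_+∞ v x) eq))))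
  ... | fin j = ≡.cong fin (i+i≡j+j⇒i≡j (fin-injective (≡.trans (≡.sym (v-* eq eq)) vxx)))

  v-1 : v 1# ≡ fin 0ℤ
  v-1 with ≉0⇒v≡fin 1≉0
  ... | k , v1≡k = ≡.trans v1≡k (≡.cong fin (i+i≡i⇒i≡0 (fin-injective
        (≡.trans (≡.sym (v-* v1≡k v1≡k)) (≡.trans (v-cong (*-identityˡ 1#)) v1≡k)))))

  v-inverse : ∀ {x y k} → x * y ≈ 1# → v x ≡ fin k → v y ≡ fin (ℤ.- k)
  v-inverse {x} {y} xy≈1 vx with ≉0⇒v≡fin (λ y≈0 → 1≉0 (trans (sym xy≈1) (trans (*-congˡ y≈0) (zeroʳ x))))
  ... | j , vy = ≡.trans vy (≡.cong fin (i+j≡0⇒j≡-i (fin-injective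
        (≡.trans (≡.sym (v-* vx vy)) (≡.trans (v-cong xy≈1) v-1)))))

  v-neg : ∀ x → v (- x) ≡ v x
  v-neg x = begin
    v (- x)                ≡⟨ v-cong (solve 1 (λ x → :- x := (:- con (+ 1)) :* x) refl x) ⟩
    v (- 1# * x)           ≡⟨ v-mult (- 1#) x ⟩
    v (- 1#) +∞ v x        ≡⟨ ≡.cong (_+∞ v x) v-[-1] ⟩
    fin 0ℤ +∞ v x          ≡⟨ +∞-identityˡ (v x) ⟩
    v x                    ∎
    where
    open ≡.≡-Reasoning
    v-[-1] : v (- 1#) ≡ fin 0ℤ
    v-[-1] = v-square-unit (≡.trans (v-cong (solve 0 (:- con (+ 1) :* :- con (+ 1) := con (+ 1)) refl)) v-1)

  inv : ∀ x → x ≉ 0# → Carrier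
  inv x x≉0 = proj₁ (inverse x x≉0)

  *-inv : ∀ x x≉0 → x * inv x x≉0 ≈ 1#
  *-inv x x≉0 = proj₂ (inverse x x≉0)

  v-inv : ∀ {x k} x≉0 → v x ≡ fin k → v (inv x x≉0) ≡ fin (ℤ.- k)
  v-inv {x} x≉0 = v-inverse (*-inv x x≉0)

  ≤ᵛ-refl : ∀ {x k} → v x ≡ fin k → k ≤ᵛ x
  ≤ᵛ-refl vx rewrite vx = fin≤fin ℤP.≤-refl

  ≤ᵛ-weaken : ∀ {i j x} → i ℤ.≤ j → j ≤ᵛ x → i ≤ᵛ x
  ≤ᵛ-weaken i≤j = ≤∞-trans (fin≤fin i≤j)

  ≤ᵛ-0 : ∀ k → k ≤ᵛ 0#
  ≤ᵛ-0 k rewrite v-0 = _ ≤∞∞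

  ≤ᵛ-cong : ∀ {k x y} → x ≈ y → k ≤ᵛ x → k ≤ᵛ y
  ≤ᵛ-cong x≈y rewrite v-cong x≈y = λ p → p

  ≤ᵛ-neg : ∀ {k x} → k ≤ᵛ x → k ≤ᵛ - x
  ≤ᵛ-neg {x = x} rewrite v-neg x = λ p → p

  ≤ᵛ-+ : ∀ {k x y} → k ≤ᵛ x → k ≤ᵛ y → k ≤ᵛ x + y
  ≤ᵛ-+ {k} {x} {y} = v-ultra x y k

  ≤ᵛ-- : ∀ {k x y} → k ≤ᵛ x → k ≤ᵛ y → k ≤ᵛ x - y
  ≤ᵛ-- p q = ≤ᵛ-+ p (≤ᵛ-neg q)

  ≤ᵛ-* : ∀ {i j x y} → i ≤ᵛ x → j ≤ᵛ y → i ℤ.+ j ≤ᵛ x * y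
  ≤ᵛ-* {x = x} {y} p q rewrite v-mult x y with v x | v y | p | q
  ... | fin _ | fin _ | fin≤fin p′ | fin≤fin q′ = fin≤fin (ℤP.+-mono-≤ p′ q′)
  ... | fin _ | ∞     | _          | _          = _ ≤∞∞
  ... | ∞     | _     | _          | _          = _ ≤∞∞

  _≤ᵛ?_ : ∀ k x → Dec (k ≤ᵛ x)
  k ≤ᵛ? x with v x
  ... | ∞     = yes (_ ≤∞∞)
  ... | fin m with k ℤP.≤? m
  ...   | yes k≤m = yes (fin≤fin k≤m)
  ...   | no  k≰m = no λ { (fin≤fin k≤m) → k≰m k≤m }

  ¬suc≤ᵛ : ∀ {x k} → v x ≡ fin k → ¬ (ℤ.suc k ≤ᵛ x)
  ¬suc≤ᵛ vx p rewrite vx with p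
  ... | fin≤fin 1+k≤k = ℤP.<-irrefl ≡.refl (ℤP.suc[i]≤j⇒i<j 1+k≤k)

  ≤ᵛ-exact : ∀ {x k} → k ≤ᵛ x → ¬ (ℤ.suc k ≤ᵛ x) → v x ≡ fin k
  ≤ᵛ-exact {x} {k} p ¬q with v x | p
  ... | ∞     | _              = ⊥-elim (¬q (_ ≤∞∞))
  ... | fin m | fin≤fin k≤m with k ℤ.≟ m
  ...   | yes k≡m = ≡.cong fin (≡.sym k≡m)
  ...   | no  k≢m = ⊥-elim (¬q (fin≤fin (ℤP.i<j⇒suc[i]≤j (ℤP.≤∧≢⇒< k≤m k≢m))))

  ≤ᵛ-all⇒≈0 : ∀ {x} → (∀ k → k ≤ᵛ x) → x ≈ 0#
  ≤ᵛ-all⇒≈0 {x} all with v x in eq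
  ... | ∞     = proj₁ (v-∞ x) eq
  ... | fin m with all (ℤ.suc m)
  ...   | fin≤fin 1+m≤m = ⊥-elim (ℤP.<-irrefl ≡.refl (ℤP.suc[i]≤j⇒i<j 1+m≤m))

  v-+-strict : ∀ {x y k} → v x ≡ fin k → ℤ.suc k ≤ᵛ y → v (x + y) ≡ fin k
  v-+-strict {x} {y} {k} vx p = ≤ᵛ-exact (≤ᵛ-+ (≤ᵛ-refl vx) (≤ᵛ-weaken (ℤP.i≤suc[i] k) p))
    λ q → ¬suc≤ᵛ vx (≤ᵛ-cong (solve 2 (λ x y → (x :+ y) :- y := x) refl x y) (≤ᵛ-- q p))

  unit⇒≉0 : ∀ {x} → Unit K x → x ≉ 0#
  unit⇒≉0 = v≡fin⇒≉0

  unit⇒¬𝔪 : ∀ {x} → Unit K x → ¬ (1ℤ ≤ᵛ x)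
  unit⇒¬𝔪 = ¬suc≤ᵛ

  integral∧¬𝔪⇒unit : ∀ {x} → Integral K x → ¬ (1ℤ ≤ᵛ x) → Unit K x
  integral∧¬𝔪⇒unit = ≤ᵛ-exact

  𝔪-prime : ∀ {x y} → Integral K x → 1ℤ ≤ᵛ x * y → 1ℤ ≤ᵛ x ⊎ 1ℤ ≤ᵛ y
  𝔪-prime {x} {y} x∈O xy∈𝔪 with 1ℤ ≤ᵛ? x
  ... | yes x∈𝔪 = inj₁ x∈𝔪
  ... | no  x∉𝔪 = inj₂ (≡.subst (fin 1ℤ ≤∞_) v[xy]≡v[y] xy∈𝔪)
    where
    v[xy]≡v[y] : v (x * y) ≡ v y
    v[xy]≡v[y] = ≡.trans (v-mult x y) (≡.trans (≡.cong (_+∞ v y) (integral∧¬𝔪⇒unit x∈O x∉𝔪)) (+∞-identityˡ (v y)))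

  ≡𝔪-reflexive : ∀ {x y} → x ≈ y → x ≡𝔪 y
  ≡𝔪-reflexive x≈y = ≤ᵛ-cong (sym (x≈y⇒x-y≈0 x≈y)) (≤ᵛ-0 1ℤ)

  ≡𝔪-refl : ∀ {x} → x ≡𝔪 x
  ≡𝔪-refl = ≡𝔪-reflexive refl

  ≡𝔪-sym : ∀ {x y} → x ≡𝔪 y → y ≡𝔪 x
  ≡𝔪-sym {x} {y} p = ≤ᵛ-cong (solve 2 (λ x y → :- (x :- y) := y :- x) refl x y) (≤ᵛ-neg p)

  ≡𝔪-trans : ∀ {x y z} → x ≡𝔪 y → y ≡𝔪 z → x ≡𝔪 z
  ≡𝔪-trans {x} {y} {z} p q = ≤ᵛ-cong (solve 3 (λ x y z → (x :- y) :+ (y :- z) := x :- z) refl x y z) (≤ᵛ-+ p q)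

  ≡𝔪-+ : ∀ {x x′ y y′} → x ≡𝔪 x′ → y ≡𝔪 y′ → x + y ≡𝔪 x′ + y′
  ≡𝔪-+ {x} {x′} {y} {y′} p q =
    ≤ᵛ-cong (solve 4 (λ x x′ y y′ → (x :- x′) :+ (y :- y′) := (x :+ y) :- (x′ :+ y′)) refl x x′ y y′) (≤ᵛ-+ p q)

  ≡𝔪-neg : ∀ {x x′} → x ≡𝔪 x′ → - x ≡𝔪 - x′
  ≡𝔪-neg {x} {x′} p = ≤ᵛ-cong (solve 2 (λ x x′ → :- (x :- x′) := (:- x) :- (:- x′)) refl x x′) (≤ᵛ-neg p)

  ≡𝔪-*ʳ : ∀ {x x′} z → Integral K z → x ≡𝔪 x′ → x * z ≡𝔪 x′ * z
  ≡𝔪-*ʳ {x} {x′} z z∈O p =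
    ≤ᵛ-cong (solve 3 (λ x x′ z → (x :- x′) :* z := x :* z :- x′ :* z) refl x x′ z) (≤ᵛ-* p z∈O)

  ≡𝔪-*ˡ : ∀ {x x′} z → Integral K z → x ≡𝔪 x′ → z * x ≡𝔪 z * x′
  ≡𝔪-*ˡ {x} {x′} z z∈O p =
    ≤ᵛ-cong (solve 3 (λ x x′ z → z :* (x :- x′) := z :* x :- z :* x′) refl x x′ z) (≤ᵛ-* z∈O p)

  ≡𝔪-* : ∀ {x x′ y y′} → Integral K x′ → Integral K y → x ≡𝔪 x′ → y ≡𝔪 y′ → x * y ≡𝔪 x′ * y′
  ≡𝔪-* {x′ = x′} {y} x′∈O y∈O p q = ≡𝔪-trans (≡𝔪-*ʳ y y∈O p) (≡𝔪-*ˡ x′ x′∈O q)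

  ≡𝔪-respects-≈ : ∀ {x x′ y y′} → x ≈ x′ → y ≈ y′ → x ≡𝔪 y → x′ ≡𝔪 y′
  ≡𝔪-respects-≈ x≈x′ y≈y′ = ≤ᵛ-cong (+-cong x≈x′ (-‿cong y≈y′))

  ∈𝔪-resp-≡𝔪 : ∀ {x y} → x ≡𝔪 y → 1ℤ ≤ᵛ y → 1ℤ ≤ᵛ x
  ∈𝔪-resp-≡𝔪 {x} {y} p y∈𝔪 = ≤ᵛ-cong (solve 2 (λ x y → (x :- y) :+ y := x) refl x y) (≤ᵛ-+ p y∈𝔪)

  ∈𝔪⇒≡𝔪0 : ∀ {x} → 1ℤ ≤ᵛ x → x ≡𝔪 0#
  ∈𝔪⇒≡𝔪0 {x} = ≤ᵛ-cong (sym (trans (+-congˡ -0#≈0#) (+-identityʳ x)))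

  unit-≡𝔪 : ∀ {x y} → Unit K y → x ≡𝔪 y → Unit K x
  unit-≡𝔪 {x} {y} y-unit p =
    ≡.trans (v-cong (solve 2 (λ x y → x := y :+ (x :- y)) refl x y)) (v-+-strict y-unit p)

  ≡𝔪-cancel-unit : ∀ {a x y} → Unit K a → a * x ≡𝔪 a * y → x ≡𝔪 y
  ≡𝔪-cancel-unit {a} {x} {y} a-unit p =
    ≡𝔪-respects-≈ (cancel x) (cancel y) (≡𝔪-*ˡ i (≤ᵛ-refl (v-inv a≉0 a-unit)) p)
    where
    a≉0 = unit⇒≉0 a-unit
    i = inv a a≉0
    cancel : ∀ z → i * (a * z) ≈ z
    cancel z = trans (solve 3 (λ a i z → i :* (a :* z) := (a :* i) :* z) refl a i z)
                     (trans (*-congʳ (*-inv a a≉0)) (*-identityˡ z))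

  square-roots-≡𝔪 : ∀ {x y} → Integral K x → Integral K y → x * x ≡𝔪 y * y → x ≡𝔪 y ⊎ x ≡𝔪 - y
  square-roots-≡𝔪 {x} {y} x∈O y∈O x²≡y² =
    Sum.map₂ (≤ᵛ-cong (solve 2 (λ x y → x :+ y := x :- (:- y)) refl x y))
      (𝔪-prime (≤ᵛ-- x∈O y∈O) (≤ᵛ-cong (solve 2 (λ x y → x :* x :- y :* y := (x :- y) :* (x :+ y)) refl x y) x²≡y²))

  ≡𝔪-inverse-unique : ∀ {x y z} → Integral K x → Integral K y → Integral K z →
                      x * y ≡𝔪 1# → x * z ≡𝔪 1# → y ≡𝔪 z
  ≡𝔪-inverse-unique {x} {y} {z} x∈O y∈O z∈O xy≡1 xz≡1 = ≡𝔪-respects-≈ (*-identityˡ y) (*-identityˡ z)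
    (≡𝔪-trans (≡𝔪-*ʳ y y∈O (≡𝔪-sym xz≡1))
    (≡𝔪-trans (≡𝔪-reflexive (solve 3 (λ x y z → (x :* z) :* y := (x :* y) :* z) refl x y z))
              (≡𝔪-*ʳ z z∈O xy≡1)))

  odd⇒∈𝔪 : ∀ {d} → Integral K d → OddVal K d → 1ℤ ≤ᵛ d
  odd⇒∈𝔪 {d} d∈O (m , v-d) with 1ℤ ≤ᵛ? d
  ... | yes d∈𝔪 = d∈𝔪
  ... | no  d∉𝔪 = ⊥-elim (odd≢even m 0ℤ (fin-injective (≡.trans (≡.sym v-d) (integral∧¬𝔪⇒unit d∈O d∉𝔪))))

  module Hensel (2-unit : Unit K (1# + 1#)) {u} (u-unit : Unit K u) where

    Approximation : ℕ → Set c
    Approximation k = Σ Carrier λ s → Unit K s × + suc k ≤ᵛ s * s - u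

    newton-step : ∀ {k} (a : Approximation k) → Σ (Approximation (suc k)) λ a′ → + suc k ≤ᵛ proj₁ a′ - proj₁ a
    newton-step {k} (s , s-unit , s²≡u) =
      (s′ , s′-unit , s′²≡u) , ≤ᵛ-cong (solve 2 (λ s t → :- t := (s :- t) :+ :- s) refl s t) (≤ᵛ-neg t-small)
      where
      2s≉0 = unit⇒≉0 (v-* 2-unit s-unit)
      i = inv ((1# + 1#) * s) 2s≉0
      t = (s * s - u) * i
      t-small : + suc k ≤ᵛ t
      t-small = ≤ᵛ-weaken (ℤP.≤-reflexive (≡.cong +_ (≡.sym (ℕP.+-identityʳ (suc k)))))
                      (≤ᵛ-* s²≡u (≤ᵛ-refl (v-inv 2s≉0 (v-* 2-unit s-unit))))
      s′ = s - t
      s′-unit : Unit K s′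
      s′-unit = v-+-strict s-unit (≤ᵛ-weaken (ℤ.+≤+ (s≤s z≤n)) (≤ᵛ-neg t-small))
      newton-error : s′ * s′ - u ≈ t * t + (s * s - u) * (1# - (1# + 1#) * s * i)
      newton-error = solve 3 (λ s u i → (s :- (s :* s :- u) :* i) :* (s :- (s :* s :- u) :* i) :- u
                          := ((s :* s :- u) :* i) :* ((s :* s :- u) :* i)
                             :+ (s :* s :- u) :* (con (+ 1) :- (con (+ 1) :+ con (+ 1)) :* s :* i)) refl s u i
      1-2si≈0 : 1# - (1# + 1#) * s * i ≈ 0#
      1-2si≈0 = x≈y⇒x-y≈0 (sym (*-inv _ 2s≉0))
      s′²≡u : + suc (suc k) ≤ᵛ s′ * s′ - u
      s′²≡u = ≤ᵛ-cong (sym newton-error) (≤ᵛ-+ (≤ᵛ-weaken (ℤ.+≤+ (s≤s (ℕP.m≤n+m (suc k) k))) (≤ᵛ-* t-small t-small))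
                                        (≤ᵛ-cong (sym (trans (*-congˡ 1-2si≈0) (zeroʳ _))) (≤ᵛ-0 _)))

    module Newton (a₀ : Approximation 0) where

      approximation : ∀ k → Approximation k
      approximation zero    = a₀
      approximation (suc k) = proj₁ (newton-step (approximation k))

      s : ℕ → Carrier
      s k = proj₁ (approximation k)

      s-close : ∀ j k → + suc k ≤ᵛ s (j ℕ.+ k) - s k
      s-close zero    k = ≤ᵛ-cong (sym (-‿inverseʳ (s k))) (≤ᵛ-0 _)
      s-close (suc j) k = ≤ᵛ-cong (solve 3 (λ a b c → (a :- b) :+ (b :- c) := a :- c) refl (s (suc j ℕ.+ k)) (s (j ℕ.+ k)) (s k))
        (≤ᵛ-+ (≤ᵛ-weaken (ℤ.+≤+ (s≤s (ℕP.m≤n+m k j))) (proj₂ (newton-step (approximation (j ℕ.+ k))))) (s-close j k))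

      s-close′ : ∀ {k m} → k ℕ.≤ m → + suc k ≤ᵛ s m - s k
      s-close′ {k} {m} k≤m = ≡.subst (λ n → + suc k ≤ᵛ s n - s k) (ℕP.m∸n+n≡m k≤m) (s-close (m ℕ.∸ k) k)

      cauchy : ∀ N → Σ ℕ λ M → ∀ m n → M ℕ.≤ m → M ℕ.≤ n → N ≤ᵛ s m - s n
      cauchy N = ℤ.∣ N ∣ , λ m n M≤m M≤n →
        ≤ᵛ-weaken (ℤP.≤-trans (i≤∣i∣ N) (ℤ.+≤+ (ℕP.n≤1+n _)))
          (≤ᵛ-cong (solve 3 (λ a b c → (a :- c) :- (b :- c) := a :- b) refl (s m) (s n) (s ℤ.∣ N ∣))
                   (≤ᵛ-- (s-close′ M≤m) (s-close′ M≤n)))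

      limit-is-root : IsSquare K u
      limit-is-root with complete s cauchy
      ... | L , s→L = L , sym (x-y≈0⇒x≈y (≤ᵛ-all⇒≈0 λ N → ≤ᵛ-weaken (i≤∣i∣ N) (bound ℤ.∣ N ∣)))
        where
        bound : ∀ N → + N ≤ᵛ L * L - u
        bound N = ≤ᵛ-cong (sym split) (≤ᵛ-- (≤ᵛ-weaken (ℤ.+≤+ (ℕP.n≤1+n N)) sₙ²≡u) cross-term)
          where
          M = proj₁ (s→L (+ N))
          n = M ℕ.⊔ N
          sₙ = s n
          sₙ-unit = proj₁ (proj₂ (approximation n))
          sₙ≡L : + N ≤ᵛ sₙ - L
          sₙ≡L = proj₂ (s→L (+ N)) n (ℕP.m≤m⊔n M N)
          sₙ²≡u : + suc N ≤ᵛ sₙ * sₙ - u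
          sₙ²≡u = ≤ᵛ-weaken (ℤ.+≤+ (s≤s (ℕP.m≤n⊔m M N))) (proj₂ (proj₂ (approximation n)))
          cross-term : + N ≤ᵛ (sₙ - L) * ((1# + 1#) * sₙ - (sₙ - L))
          cross-term = ≤ᵛ-weaken (ℤP.≤-reflexive (≡.cong +_ (≡.sym (ℕP.+-identityʳ N))))
            (≤ᵛ-* sₙ≡L (≤ᵛ-- (≤ᵛ-* (≤ᵛ-refl 2-unit) (≤ᵛ-refl sₙ-unit)) (≤ᵛ-weaken (ℤ.+≤+ z≤n) sₙ≡L)))
          split : L * L - u ≈ (sₙ * sₙ - u) - (sₙ - L) * ((1# + 1#) * sₙ - (sₙ - L))
          split = solve 3 (λ L u s → L :* L :- u := (s :* s :- u) :- (s :- L) :* ((con (+ 1) :+ con (+ 1)) :* s :- (s :- L))) refl L u sₙ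

    hensel : ∀ {z} → u ≡𝔪 z * z → IsSquare K u
    hensel {z} u≡z² = Newton.limit-is-root (z , z-unit , ≡𝔪-sym u≡z²)
      where
      z-unit : Unit K z
      z-unit = v-square-unit (unit-≡𝔪 u-unit (≡𝔪-sym u≡z²))

module Squares {c ℓ} (K : NALocalField c ℓ) where
  open NALocalField K
  open Valuation K
  open ℤ-Coefficients cring

  square-≈ : ∀ {x y} → x ≈ y → IsSquare K x → IsSquare K y
  square-≈ x≈y (s , x≈s²) = s , trans (sym x≈y) x≈s²

  square-* : ∀ {x y} → IsSquare K x → IsSquare K y → IsSquare K (x * y)
  square-* (s , x≈s²) (t , y≈t²) = s * t ,
    trans (*-cong x≈s² y≈t²) (solve 2 (λ s t → (s :* s) :* (t :* t) := (s :* t) :* (s :* t)) refl s t)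

  square-x² : ∀ x → IsSquare K (x * x)
  square-x² x = x , refl

  square-1 : IsSquare K 1#
  square-1 = 1# , sym (*-identityˡ 1#)

  square-cancelˡ : ∀ {x y} → x ≉ 0# → IsSquare K x → IsSquare K (x * y) → IsSquare K y
  square-cancelˡ {x} {y} x≉0 (s , x≈s²) (t , xy≈t²) = t * i , sym (begin
    (t * i) * (t * i)          ≈⟨ solve 2 (λ t i → (t :* i) :* (t :* i) := (t :* t) :* (i :* i)) refl t i ⟩
    (t * t) * (i * i)          ≈⟨ *-congʳ (trans (sym xy≈t²) (*-congʳ x≈s²)) ⟩
    ((s * s) * y) * (i * i)    ≈⟨ solve 3 (λ s y i → ((s :* s) :* y) :* (i :* i) := y :* ((s :* i) :* (s :* i))) refl s y i ⟩
    y * ((s * i) * (s * i))    ≈⟨ *-congˡ (*-cong (*-inv s s≉0) (*-inv s s≉0)) ⟩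
    y * (1# * 1#)              ≈⟨ trans (*-congˡ (*-identityˡ 1#)) (*-identityʳ y) ⟩
    y                          ∎)
    where
    open import Relation.Binary.Reasoning.Setoid setoid
    s≉0 : s ≉ 0#
    s≉0 s≈0 = x≉0 (trans x≈s² (trans (*-congʳ s≈0) (zeroˡ s)))
    i = inv s s≉0

  infix 4 _~_
  _~_ : Carrier → Carrier → Set (c ⊔ ℓ)
  _~_ = SqClassEq K

  ~-refl : ∀ {x} → x ≉ 0# → x ~ x
  ~-refl {x} x≉0 = x≉0 , x≉0 , square-x² x

  ~-sym : ∀ {x y} → x ~ y → y ~ x
  ~-sym (x≉0 , y≉0 , xy-square) = y≉0 , x≉0 , square-≈ (*-comm _ _) xy-square

  ~-trans : ∀ {x y z} → x ~ y → y ~ z → x ~ z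
  ~-trans {x} {y} {z} (x≉0 , y≉0 , xy-square) (_ , z≉0 , yz-square) = x≉0 , z≉0 ,
    square-cancelˡ (*-≉0 y≉0 y≉0) (square-x² y)
      (square-≈ (solve 3 (λ x y z → (x :* y) :* (y :* z) := (y :* y) :* (x :* z)) refl x y z) (square-* xy-square yz-square))

  ~-* : ∀ {x x′ y y′} → x ~ x′ → y ~ y′ → x * y ~ x′ * y′
  ~-* {x} {x′} {y} {y′} (x≉0 , x′≉0 , xx′-square) (y≉0 , y′≉0 , yy′-square) = *-≉0 x≉0 y≉0 , *-≉0 x′≉0 y′≉0 ,
    square-≈ (solve 4 (λ x x′ y y′ → (x :* x′) :* (y :* y′) := (x :* y) :* (x′ :* y′)) refl x x′ y y′)
             (square-* xx′-square yy′-square)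

  ~-reflexive : ∀ {x y} → x ≈ y → y ≉ 0# → x ~ y
  ~-reflexive x≈y y≉0 = (λ x≈0 → y≉0 (trans (sym x≈y) x≈0)) , y≉0 , square-≈ (*-congʳ (sym x≈y)) (square-x² _)

  square⇒~1 : ∀ {x} → x ≉ 0# → IsSquare K x → x ~ 1#
  square⇒~1 {x} x≉0 x-square = x≉0 , 1≉0 , square-≈ (sym (*-identityʳ x)) x-square

  ~1⇒square : ∀ {x} → x ~ 1# → IsSquare K x
  ~1⇒square (_ , _ , x1-square) = square-≈ (*-identityʳ _) x1-square

  infix 4 _∼²_
  _∼²_ : Pair K → Pair K → Set (c ⊔ ℓ)
  _∼²_ = _∼_ K

  ∼²-sym : ∀ {p p′} → p ∼² p′ → p′ ∼² p
  ∼²-sym (x~x′ , y~y′) = ~-sym x~x′ , ~-sym y~y′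

  ∼²-trans : ∀ {p p′ p″} → p ∼² p′ → p′ ∼² p″ → p ∼² p″
  ∼²-trans (x~x′ , y~y′) (x′~x″ , y′~y″) = ~-trans x~x′ x′~x″ , ~-trans y~y′ y′~y″

  square-*-~ : ∀ {s x} → s ≉ 0# → IsSquare K s → x ≉ 0# → s * x ~ x
  square-*-~ s≉0 s-square x≉0 = ~-trans (~-* (square⇒~1 s≉0 s-square) (~-refl x≉0)) (~-reflexive (*-identityˡ _) x≉0)

  *-square-~ : ∀ {x s} → x ≉ 0# → s ≉ 0# → IsSquare K s → x * s ~ x
  *-square-~ x≉0 s≉0 s-square = ~-trans (~-reflexive (*-comm _ _) (*-≉0 s≉0 x≉0)) (square-*-~ s≉0 s-square x≉0)

q≡1[4]⇒odd : ∀ {q} → q % 4 ≡ 1 → q ≡ suc ((q / 4 ℕ.* 2) ℕ.* 2)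
q≡1[4]⇒odd {q} q%4≡1 = ≡.trans (m≡m%n+[m/n]*n q 4) (≡.cong₂ ℕ._+_ q%4≡1 (4t≡[2t]2 (q / 4)))
  where
  4t≡[2t]2 : ∀ t → t ℕ.* 4 ≡ (t ℕ.* 2) ℕ.* 2
  4t≡[2t]2 = ℕ-solve-∀

module ResidueField {c ℓ} (K : NALocalField c ℓ) (k : ℕ) (q≡2k+1 : NALocalField.q K ≡ suc (k ℕ.* 2)) where
  open NALocalField K
  open Valuation K
  open ℤ-Coefficients cring
  open import Algebra.Properties.Ring ring using (-‿involutive)

  residue : ∀ x → Integral K x → Fin q
  residue x x∈O = proj₁ (rep-surj x x∈O)

  residue-≡𝔪 : ∀ x x∈O → rep (residue x x∈O) ≡𝔪 x
  residue-≡𝔪 x x∈O = ≡𝔪-sym (proj₂ (rep-surj x x∈O))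

  rep-injective : ∀ {i j} → rep i ≡𝔪 rep j → i ≡ j
  rep-injective = rep-inj _ _

  rep-cong : ∀ {i j} → i ≡ j → rep i ≡𝔪 rep j
  rep-cong i≡j = ≡𝔪-reflexive (reflexive (≡.cong rep i≡j))

  residue-unique : ∀ {x} x∈O {j} → rep j ≡𝔪 x → residue x x∈O ≡ j
  residue-unique {x} x∈O p = rep-injective (≡𝔪-trans (residue-≡𝔪 x x∈O) (≡𝔪-sym p))

  1∉𝔪 : ¬ (1ℤ ≤ᵛ 1#)
  1∉𝔪 = unit⇒¬𝔪 v-1

  -- If 2 ∈ 𝔪 then x ↦ x + 1 would pair off the q residues.
  2-unit : Unit K (1# + 1#)
  2-unit with 1ℤ ≤ᵛ? 1# + 1#
  ... | no  2∉𝔪 = integral∧¬𝔪⇒unit (≤ᵛ-+ (≤ᵛ-refl v-1) (≤ᵛ-refl v-1)) 2∉𝔪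
  ... | yes 2∈𝔪 = ⊥-elim (even≢odd m k (≡.trans (≡.sym q≡2m) q≡2k+1))
    where
    σ : Fin q → Fin q
    σ i = residue (rep i + 1#) (≤ᵛ-+ (rep-int i) (≤ᵛ-refl v-1))
    σ-≡𝔪 : ∀ i → rep (σ i) ≡𝔪 rep i + 1#
    σ-≡𝔪 i = residue-≡𝔪 _ _
    shift : FreeInvolution {q} (λ _ → ⊤)
    shift = record
      { σ                = σ
      ; σ-closed         = λ _ → tt
      ; σ-involutive     = λ {i} _ → rep-injective (≡𝔪-trans (σ-≡𝔪 (σ i))
          (≡𝔪-trans (≡𝔪-+ (σ-≡𝔪 i) ≡𝔪-refl)
          (≡𝔪-respects-≈ (sym (+-assoc _ _ _)) (+-identityʳ _) (≡𝔪-+ (≡𝔪-refl {rep i}) (∈𝔪⇒≡𝔪0 2∈𝔪)))))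
      ; σ-fixedPointFree = λ {i} _ σi≡i → 1∉𝔪 (≤ᵛ-cong (solve 2 (λ x y → (x :+ y) :- x := y) refl (rep i) 1#)
          (≡𝔪-sym (≡𝔪-trans (rep-cong (≡.sym σi≡i)) (σ-≡𝔪 i))))
      }
    m = proj₁ (even-count (λ _ → yes tt) shift)
    q≡2m : q ≡ m ℕ.* 2
    q≡2m = ≡.trans (≡.sym (count-all (λ _ → yes tt) (λ _ → tt))) (proj₂ (even-count (λ _ → yes tt) shift))

  hensel : ∀ {u z} → Unit K u → u ≡𝔪 z * z → IsSquare K u
  hensel u-unit = Hensel.hensel 2-unit u-unit

  Nonzero : Fin q → Set
  Nonzero i = ¬ (1ℤ ≤ᵛ rep i)

  nonzero? : Decidable Nonzero
  nonzero? i = ¬? (1ℤ ≤ᵛ? rep i)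

  nonzero⇒unit : ∀ {i} → Nonzero i → Unit K (rep i)
  nonzero⇒unit = integral∧¬𝔪⇒unit (rep-int _)

  IsSquareMod : Carrier → Set
  IsSquareMod x = ∃ λ j → x ≡𝔪 rep j * rep j

  isSquareMod? : ∀ x → Dec (IsSquareMod x)
  isSquareMod? x = FinP.any? λ j → 1ℤ ≤ᵛ? x - rep j * rep j

  SquareMultiple : Carrier → Fin q → Set
  SquareMultiple a b = ∃ λ x → Nonzero x × rep b ≡𝔪 a * (rep x * rep x)

  squareMultiple? : ∀ a → Decidable (SquareMultiple a)
  squareMultiple? a b = FinP.any? λ x → nonzero? x ×-dec (1ℤ ≤ᵛ? rep b - a * (rep x * rep x))

  negation : Fin q → Fin q
  negation i = residue (- rep i) (≤ᵛ-neg (rep-int i))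

  negation-≡𝔪 : ∀ i → rep (negation i) ≡𝔪 - rep i
  negation-≡𝔪 i = residue-≡𝔪 _ _

  negation-involution : FreeInvolution Nonzero
  negation-involution = record
    { σ                = negation
    ; σ-closed         = λ {i} i≢0 -i∈𝔪 →
        i≢0 (≤ᵛ-cong (-‿involutive _) (≤ᵛ-neg (∈𝔪-resp-≡𝔪 (≡𝔪-sym (negation-≡𝔪 i)) -i∈𝔪)))
    ; σ-involutive     = λ {i} _ → rep-injective (≡𝔪-trans (negation-≡𝔪 (negation i))
        (≡𝔪-trans (≡𝔪-neg (negation-≡𝔪 i)) (≡𝔪-reflexive (-‿involutive _))))
    ; σ-fixedPointFree = λ {i} i≢0 -i≡i → [ unit⇒¬𝔪 2-unit , i≢0 ]′ (𝔪-prime (≤ᵛ-refl 2-unit) (2i∈𝔪 i -i≡i))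
    }
    where
    2i∈𝔪 : ∀ i → negation i ≡ i → 1ℤ ≤ᵛ (1# + 1#) * rep i
    2i∈𝔪 i -i≡i = ≤ᵛ-cong (solve 1 (λ x → x :- (:- x) := (con (+ 1) :+ con (+ 1)) :* x) refl (rep i))
      (≡𝔪-trans (rep-cong (≡.sym -i≡i)) (negation-≡𝔪 i))

  squaring-cover : ∀ {a} → Unit K a → DoubleCover Nonzero (SquareMultiple a)
  squaring-cover {a} a-unit = record
    { involution = negation-involution
    ; f          = square
    ; f-into     = λ {x} x≢0 → x , x≢0 , residue-≡𝔪 _ _
    ; f-onto     = λ (x , x≢0 , b≡ax²) → x , x≢0 , residue-unique _ b≡ax²
    ; f-σ        = λ {i} _ → residue-unique _ (≡𝔪-trans (residue-≡𝔪 _ _) (≡𝔪-*ˡ a a∈O (≡𝔪-sym (-i²≡i² i))))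
    ; f-fibres   = λ {x} {x′} _ _ fx′≡fx →
        Sum.map rep-injective (λ p → rep-injective (≡𝔪-trans p (≡𝔪-sym (negation-≡𝔪 x))))
        (square-roots-≡𝔪 (rep-int x′) (rep-int x) (≡𝔪-cancel-unit a-unit
          (≡𝔪-trans (≡𝔪-sym (residue-≡𝔪 _ _)) (≡𝔪-trans (rep-cong fx′≡fx) (residue-≡𝔪 _ _)))))
    }
    where
    a∈O = ≤ᵛ-refl a-unit
    square : Fin q → Fin q
    square i = residue (a * (rep i * rep i)) (≤ᵛ-* a∈O (≤ᵛ-* (rep-int i) (rep-int i)))
    -i²≡i² : ∀ i → rep (negation i) * rep (negation i) ≡𝔪 rep i * rep i
    -i²≡i² i = ≡𝔪-trans (≡𝔪-* (≤ᵛ-neg (rep-int i)) (rep-int _) (negation-≡𝔪 i) (negation-≡𝔪 i))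
                         (≡𝔪-reflexive (solve 1 (λ x → (:- x) :* (:- x) := x :* x) refl (rep i)))

  count-nonzero : ∀ {a} → Unit K a → count Nonzero nonzero? ≡ count (SquareMultiple a) (squareMultiple? a) ℕ.* 2
  count-nonzero a-unit = count-double nonzero? (squareMultiple? _) (squaring-cover a-unit)

  NonzeroSquare NonzeroNonsquare : Fin q → Set
  NonzeroSquare    i = Nonzero i × IsSquareMod (rep i)
  NonzeroNonsquare i = Nonzero i × ¬ IsSquareMod (rep i)

  nonzeroSquare? : Decidable NonzeroSquare
  nonzeroSquare? i = nonzero? i ×-dec isSquareMod? (rep i)

  nonzeroNonsquare? : Decidable NonzeroNonsquare
  nonzeroNonsquare? i = nonzero? i ×-dec ¬? (isSquareMod? (rep i))

  count-nonzeroSquare : count NonzeroSquare nonzeroSquare? ≡ count (SquareMultiple 1#) (squareMultiple? 1#)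
  count-nonzeroSquare = count-cong nonzeroSquare? (squareMultiple? 1#)
    (λ i (i≢0 , j , i≡j²) → j , (λ j∈𝔪 → i≢0 (∈𝔪-resp-≡𝔪 i≡j² (≤ᵛ-* j∈𝔪 (rep-int j)))) ,
                            ≡𝔪-respects-≈ refl (sym (*-identityˡ _)) i≡j²)
    (λ i (j , j≢0 , i≡j²) → (λ i∈𝔪 → unit⇒¬𝔪 (v-* (nonzero⇒unit j≢0) (nonzero⇒unit j≢0))
                                (∈𝔪-resp-≡𝔪 (≡𝔪-respects-≈ (*-identityˡ _) refl (≡𝔪-sym i≡j²)) i∈𝔪)) ,
                            j , ≡𝔪-respects-≈ refl (*-identityˡ _) i≡j²)

  squareMultiple⇒nonsquare : ∀ {a} → Unit K a → ¬ IsSquareMod a → ∀ i → SquareMultiple a i → NonzeroNonsquare i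
  squareMultiple⇒nonsquare {a} a-unit a-nonsquare i (x , x≢0 , i≡ax²) = i≢0 , i-nonsquare
    where
    x-unit = nonzero⇒unit x≢0
    x≉0 = unit⇒≉0 x-unit
    y = inv (rep x) x≉0
    y∈O = ≤ᵛ-refl (v-inv x≉0 x-unit)
    i≢0 : Nonzero i
    i≢0 = unit⇒¬𝔪 (unit-≡𝔪 (v-* a-unit (v-* x-unit x-unit)) i≡ax²)
    ax²y²≈a : a * (rep x * rep x) * (y * y) ≈ a
    ax²y²≈a = trans (solve 3 (λ a x y → a :* (x :* x) :* (y :* y) := a :* ((x :* y) :* (x :* y))) refl a (rep x) y)
                    (trans (*-congˡ (*-cong (*-inv _ x≉0) (*-inv _ x≉0))) (trans (*-congˡ (*-identityˡ 1#)) (*-identityʳ a)))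
    i-nonsquare : ¬ IsSquareMod (rep i)
    i-nonsquare (j , i≡j²) = a-nonsquare (residue (rep j * y) jy∈O , a≡[jy]²)
      where
      jy∈O = ≤ᵛ-* (rep-int j) y∈O
      a≡[jy]² : a ≡𝔪 _
      a≡[jy]² = ≡𝔪-trans (≡𝔪-respects-≈ ax²y²≈a (solve 2 (λ j y → j :* j :* (y :* y) := (j :* y) :* (j :* y)) refl (rep j) y)
                            (≡𝔪-*ʳ (y * y) (≤ᵛ-* y∈O y∈O) (≡𝔪-trans (≡𝔪-sym i≡ax²) i≡j²)))
                         (≡𝔪-sym (≡𝔪-* jy∈O (rep-int _) (residue-≡𝔪 _ _) (residue-≡𝔪 _ _)))

  count-nonzeroNonsquare : count NonzeroNonsquare nonzeroNonsquare? ≡ count (SquareMultiple 1#) (squareMultiple? 1#)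
  count-nonzeroNonsquare = ℕP.+-cancelˡ-≡ n₁ (count NonzeroNonsquare nonzeroNonsquare?) n₁ (begin
    n₁ ℕ.+ count NonzeroNonsquare nonzeroNonsquare?                   ≡⟨ ≡.cong (ℕ._+ count NonzeroNonsquare nonzeroNonsquare?) count-nonzeroSquare ⟨
    count NonzeroSquare nonzeroSquare? ℕ.+ count NonzeroNonsquare nonzeroNonsquare?
                                                                     ≡⟨ count-split nonzero? (λ i → isSquareMod? (rep i)) ⟨
    count Nonzero nonzero?                                            ≡⟨ count-nonzero v-1 ⟩
    n₁ ℕ.* 2                                                          ≡⟨ ℕP.*-comm n₁ 2 ⟩
    n₁ ℕ.+ (n₁ ℕ.+ 0)                                                 ≡⟨ ≡.cong (n₁ ℕ.+_) (ℕP.+-identityʳ n₁) ⟩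
    n₁ ℕ.+ n₁                                                         ∎)
    where
    open ≡.≡-Reasoning
    n₁ = count (SquareMultiple 1#) (squareMultiple? 1#)

  -- The a x² (x ≢ 0) are among the nonsquares, and there are equally many of both.
  nonsquare-ratio : ∀ {a b} → Unit K a → ¬ IsSquareMod a → Unit K b → ¬ IsSquareMod b →
                    ∃ λ x → b ≡𝔪 a * (rep x * rep x)
  nonsquare-ratio {a} {b} a-unit a-nonsquare b-unit b-nonsquare =
    let x , _ , b̄≡ax² = nonsquare⊆multiple (residue b b∈O) b̄-nonsquare
    in x , ≡𝔪-trans (≡𝔪-sym (residue-≡𝔪 b b∈O)) b̄≡ax²
    where
    b∈O = ≤ᵛ-refl b-unit
    multiples≡nonsquares : count (SquareMultiple a) (squareMultiple? a) ≡ count NonzeroNonsquare nonzeroNonsquare?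
    multiples≡nonsquares = ≡.sym (≡.trans count-nonzeroNonsquare
      (ℕP.*-cancelʳ-≡ _ _ 2 (≡.trans (≡.sym (count-nonzero v-1)) (count-nonzero a-unit))))
    nonsquare⊆multiple : ∀ i → NonzeroNonsquare i → SquareMultiple a i
    nonsquare⊆multiple = ⊆∧count≤⇒⊇ (squareMultiple? a) nonzeroNonsquare?
      (squareMultiple⇒nonsquare a-unit a-nonsquare) (ℕP.≤-reflexive (≡.sym multiples≡nonsquares))
    b̄-nonsquare : NonzeroNonsquare (residue b b∈O)
    b̄-nonsquare = unit⇒¬𝔪 (unit-≡𝔪 b-unit (residue-≡𝔪 b b∈O)) ,
                  λ (j , b̄≡j²) → b-nonsquare (j , ≡𝔪-trans (≡𝔪-sym (residue-≡𝔪 b b∈O)) b̄≡j²)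

  q≡1+count-nonzero : q ≡ suc (count Nonzero nonzero?)
  q≡1+count-nonzero = begin
    q                                   ≡⟨ count-all all? (λ _ → tt) ⟨
    count All all?                      ≡⟨ count-remove all? {0̄} tt ⟩
    suc (count (All ∖ 0̄) (all? ∖? 0̄))   ≡⟨ ≡.cong suc (count-cong (all? ∖? 0̄) nonzero? to from) ⟩
    suc (count Nonzero nonzero?)        ∎
    where
    open ≡.≡-Reasoning
    All : Fin q → Set
    All _ = ⊤
    all? : Decidable All
    all? _ = yes tt
    0̄ = residue 0# (≤ᵛ-0 0ℤ)
    0̄∈𝔪 : 1ℤ ≤ᵛ rep 0̄
    0̄∈𝔪 = ∈𝔪-resp-≡𝔪 (residue-≡𝔪 _ _) (≤ᵛ-0 1ℤ)
    to : ∀ i → (All ∖ 0̄) i → Nonzero i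
    to i (_ , i≢0̄) i∈𝔪 = i≢0̄ (rep-injective (≤ᵛ-- i∈𝔪 0̄∈𝔪))
    from : ∀ i → Nonzero i → (All ∖ 0̄) i
    from i i≢0 = tt , λ i≡0̄ → i≢0 (∈𝔪-resp-≡𝔪 (rep-cong i≡0̄) 0̄∈𝔪)

  reciprocal : Fin q → Fin q
  reciprocal i with 1ℤ ≤ᵛ? rep i
  ... | yes _   = i
  ... | no  i≢0 = residue (inv (rep i) (unit⇒≉0 (nonzero⇒unit i≢0))) (≤ᵛ-refl (v-inv _ (nonzero⇒unit i≢0)))

  reciprocal-inverse : ∀ {i} → Nonzero i → rep i * rep (reciprocal i) ≡𝔪 1#
  reciprocal-inverse {i} i≢0 with 1ℤ ≤ᵛ? rep i
  ... | yes i∈𝔪 = ⊥-elim (i≢0 i∈𝔪)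
  ... | no  _   = ≡𝔪-trans (≡𝔪-*ˡ (rep i) (rep-int i) (residue-≡𝔪 _ _)) (≡𝔪-reflexive (*-inv _ _))

  reciprocal-nonzero : ∀ {i} → Nonzero i → Nonzero (reciprocal i)
  reciprocal-nonzero i≢0 i⁻¹∈𝔪 =
    1∉𝔪 (∈𝔪-resp-≡𝔪 (≡𝔪-sym (reciprocal-inverse i≢0)) (≤ᵛ-* (rep-int _) i⁻¹∈𝔪))

  reciprocal-involutive : ∀ {i} → Nonzero i → reciprocal (reciprocal i) ≡ i
  reciprocal-involutive i≢0 = rep-injective (≡𝔪-inverse-unique (rep-int _) (rep-int _) (rep-int _)
    (reciprocal-inverse (reciprocal-nonzero i≢0)) (≡𝔪-respects-≈ (*-comm _ _) refl (reciprocal-inverse i≢0)))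

  reciprocal-square : ∀ {i} → NonzeroSquare i → IsSquareMod (rep (reciprocal i))
  reciprocal-square {i} (i≢0 , j , i≡j²) =
    residue (s * rep j) sj∈O , ≡𝔪-trans s≡[sj]² (≡𝔪-sym (≡𝔪-* sj∈O (rep-int _) (residue-≡𝔪 _ _) (residue-≡𝔪 _ _)))
    where
    s = rep (reciprocal i)
    sj∈O = ≤ᵛ-* (rep-int (reciprocal i)) (rep-int j)
    s≡[sj]² : s ≡𝔪 (s * rep j) * (s * rep j)
    s≡[sj]² = ≡𝔪-sym (≡𝔪-trans (≡𝔪-reflexive (solve 2 (λ s j → (s :* j) :* (s :* j) := (s :* s) :* (j :* j)) refl s (rep j)))
                     (≡𝔪-trans (≡𝔪-*ˡ (s * s) (≤ᵛ-* (rep-int _) (rep-int _)) (≡𝔪-sym i≡j²))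
                     (≡𝔪-trans (≡𝔪-reflexive (solve 2 (λ s r → (s :* s) :* r := s :* (r :* s)) refl s (rep i)))
                     (≡𝔪-trans (≡𝔪-*ˡ s (rep-int _) (reciprocal-inverse i≢0)) (≡𝔪-reflexive (*-identityʳ s))))))

  -- If −1 were no square mod 𝔪, the inversion would pair off the k − 1 nonzero squares other than 1.
  -1-squareMod : ∀ t → k ≡ t ℕ.* 2 → IsSquareMod (- 1#)
  -1-squareMod t k≡2t with isSquareMod? (- 1#)
  ... | yes -1≡j²         = -1≡j²
  ... | no  -1-nonsquare = ⊥-elim (even≢odd t m (≡.trans (≡.sym k≡2t) (≡.trans (≡.sym count≡k) count≡2m+1)))
    where
    count≡k : count NonzeroSquare nonzeroSquare? ≡ k
    count≡k = ≡.trans count-nonzeroSquare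
      (ℕP.*-cancelʳ-≡ _ _ 2 (≡.trans (≡.sym (count-nonzero v-1))
                              (ℕP.suc-injective (≡.trans (≡.sym q≡1+count-nonzero) q≡2k+1))))
    1̄ = residue 1# (≤ᵛ-refl v-1)
    1̄≡1 : rep 1̄ ≡𝔪 1#
    1̄≡1 = residue-≡𝔪 _ _
    1̄-square : NonzeroSquare 1̄
    1̄-square = unit⇒¬𝔪 (unit-≡𝔪 v-1 1̄≡1) , 1̄ ,
      ≡𝔪-trans 1̄≡1 (≡𝔪-sym (≡𝔪-trans (≡𝔪-* (≤ᵛ-refl v-1) (rep-int 1̄) 1̄≡1 1̄≡1)
                                     (≡𝔪-reflexive (*-identityˡ 1#))))
    reciprocal-≢1̄ : ∀ {i} → Nonzero i → i ≢ 1̄ → reciprocal i ≢ 1̄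
    reciprocal-≢1̄ {i} i≢0 i≢1̄ i⁻¹≡1̄ = i≢1̄ (rep-injective (≡𝔪-trans
      (≡𝔪-inverse-unique (rep-int _) (rep-int i) (≤ᵛ-refl v-1)
        (≡𝔪-respects-≈ (*-comm _ _) refl (reciprocal-inverse i≢0))
        (≡𝔪-respects-≈ (sym (*-identityʳ _)) refl (≡𝔪-trans (rep-cong i⁻¹≡1̄) 1̄≡1)))
      (≡𝔪-sym 1̄≡1)))
    i²≡1 : ∀ {i} → Nonzero i → reciprocal i ≡ i → rep i * rep i ≡𝔪 1# * 1#
    i²≡1 {i} i≢0 i⁻¹≡i = ≡𝔪-respects-≈ refl (sym (*-identityˡ 1#))
      (≡𝔪-trans (≡𝔪-*ˡ (rep i) (rep-int i) (rep-cong (≡.sym i⁻¹≡i))) (reciprocal-inverse i≢0))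
    inversion : FreeInvolution (NonzeroSquare ∖ 1̄)
    inversion = record
      { σ                = reciprocal
      ; σ-closed         = λ ((i≢0 , i-square) , i≢1̄) →
          (reciprocal-nonzero i≢0 , reciprocal-square (i≢0 , i-square)) , reciprocal-≢1̄ i≢0 i≢1̄
      ; σ-involutive     = λ ((i≢0 , _) , _) → reciprocal-involutive i≢0
      ; σ-fixedPointFree = λ {i} ((i≢0 , j , i≡j²) , i≢1̄) i⁻¹≡i →
          [ (λ i≡1 → i≢1̄ (rep-injective (≡𝔪-trans i≡1 (≡𝔪-sym 1̄≡1))))
          , (λ i≡-1 → -1-nonsquare (j , ≡𝔪-trans (≡𝔪-sym i≡-1) i≡j²)) ]′
          (square-roots-≡𝔪 (rep-int i) (≤ᵛ-refl v-1) (i²≡1 i≢0 i⁻¹≡i))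
      }
    m = proj₁ (even-count (nonzeroSquare? ∖? 1̄) inversion)
    count≡2m+1 : count NonzeroSquare nonzeroSquare? ≡ suc (m ℕ.* 2)
    count≡2m+1 = ≡.trans (count-remove nonzeroSquare? 1̄-square) (≡.cong suc (proj₂ (even-count (nonzeroSquare? ∖? 1̄) inversion)))

  square⇒squareMod : ∀ {u} → Unit K u → IsSquare K u → IsSquareMod u
  square⇒squareMod {u} u-unit (z , u≈z²) = residue z z∈O , ≡𝔪-trans (≡𝔪-reflexive u≈z²)
    (≡𝔪-sym (≡𝔪-* z∈O (rep-int _) (residue-≡𝔪 z z∈O) (residue-≡𝔪 z z∈O)))
    where
    z∈O = ≤ᵛ-refl (v-square-unit (≡.trans (v-cong (sym u≈z²)) u-unit))

  isSquare? : ∀ {u} → Unit K u → Dec (IsSquare K u)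
  isSquare? {u} u-unit with isSquareMod? u
  ... | yes (j , u≡j²) = yes (hensel u-unit u≡j²)
  ... | no  ¬u≡j²      = no (¬u≡j² ∘ square⇒squareMod u-unit)

  nonsquare-units-product : ∀ {a b} → Unit K a → Unit K b → ¬ IsSquare K a → ¬ IsSquare K b → IsSquare K (a * b)
  nonsquare-units-product {a} {b} a-unit b-unit a-nonsquare b-nonsquare =
    let x , b≡ax² = nonsquare-ratio a-unit (a-nonsquare ∘ squareMod⇒square a-unit) b-unit (b-nonsquare ∘ squareMod⇒square b-unit)
    in hensel (v-* a-unit b-unit) (≡𝔪-trans (≡𝔪-*ˡ a (≤ᵛ-refl a-unit) b≡ax²)
         (≡𝔪-reflexive (solve 2 (λ a x → a :* (a :* (x :* x)) := (a :* x) :* (a :* x)) refl a (rep x))))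
    where
    squareMod⇒square : ∀ {u} → Unit K u → IsSquareMod u → IsSquare K u
    squareMod⇒square u-unit (j , u≡j²) = hensel u-unit u≡j²

  -1-square : ∀ t → k ≡ t ℕ.* 2 → IsSquare K (- 1#)
  -1-square t k≡2t = hensel (≡.trans (v-neg 1#) v-1) (proj₂ (-1-squareMod t k≡2t))

module SquareClasses {c ℓ} (K : NALocalField c ℓ) (q≡1[4] : NALocalField.q K % 4 ≡ 1)
                     (π ε : NALocalField.Carrier K) (v-π : NALocalField.v K π ≡ fin 1ℤ)
                     (ε-unit : Unit K ε) (ε-nonsquare : ¬ IsSquare K ε) where
  open NALocalField K
  open Valuation K
  open Squares K
  module 𝔽 = ResidueField K (q / 4 ℕ.* 2) (q≡1[4]⇒odd q≡1[4])
  open 𝔽 using (hensel; isSquare?; nonsquare-units-product)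
  open ℤ-Coefficients cring

  power : Carrier → Fin 2 → Carrier
  power x F.zero    = 1#
  power x (F.suc _) = x

  π≉0 : π ≉ 0#
  π≉0 = v≡fin⇒≉0 v-π

  ε≉0 : ε ≉ 0#
  ε≉0 = unit⇒≉0 ε-unit

  power-π≉0 : ∀ e → power π e ≉ 0#
  power-π≉0 F.zero    = 1≉0
  power-π≉0 (F.suc _) = π≉0

  power-ε≉0 : ∀ f → power ε f ≉ 0#
  power-ε≉0 F.zero    = 1≉0
  power-ε≉0 (F.suc _) = ε≉0

  unit-class : ∀ {w} → Unit K w → ∃ λ f → w ~ power ε f
  unit-class w-unit with isSquare? w-unit
  ... | yes w-square    = F.zero , square⇒~1 (unit⇒≉0 w-unit) w-square
  ... | no  w-nonsquare = F.suc F.zero , unit⇒≉0 w-unit , ε≉0 , nonsquare-units-product w-unit ε-unit w-nonsquare ε-nonsquare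

  π⁻¹ : Carrier
  π⁻¹ = inv π π≉0

  π^ : ℤ → Carrier
  π^ (+ zero)       = 1#
  π^ (+ suc n)      = π * π^ (+ n)
  π^ -[1+ zero ]    = π⁻¹
  π^ -[1+ suc n ]   = π⁻¹ * π^ -[1+ n ]

  v-π^ : ∀ k → v (π^ k) ≡ fin k
  v-π^ (+ zero)     = v-1
  v-π^ (+ suc n)    = v-* v-π (v-π^ (+ n))
  v-π^ -[1+ zero ]  = v-inv π≉0 v-π
  v-π^ -[1+ suc n ] = v-* (v-inv π≉0 v-π) (v-π^ -[1+ n ])

  ~-square-multiple : ∀ {x w s} → s ≉ 0# → x ≈ w * (s * s) → w ≉ 0# → x ~ w
  ~-square-multiple {x} {w} {s} s≉0 x≈ws² w≉0 = (λ x≈0 → *-≉0 w≉0 (*-≉0 s≉0 s≉0) (trans (sym x≈ws²) x≈0)) , w≉0 ,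
    square-≈ (trans (solve 2 (λ w s → (w :* s) :* (w :* s) := (w :* (s :* s)) :* w) refl w s) (*-congʳ (sym x≈ws²)))
             (square-x² (w * s))

  even-class : ∀ {x k} → v x ≡ fin (k ℤ.+ k) → ∃ λ f → x ~ power ε f
  even-class {x} {k} v-x =
    let (f , w~εᶠ) = unit-class w-unit in f , ~-trans (~-square-multiple P≉0 x≈wP² (unit⇒≉0 w-unit)) w~εᶠ
    where
    P = π^ k
    P≉0 = v≡fin⇒≉0 (v-π^ k)
    P⁻¹ = inv P P≉0
    w = x * (P⁻¹ * P⁻¹)
    w-unit : Unit K w
    w-unit = ≡.trans (v-* v-x (v-* (v-inv P≉0 (v-π^ k)) (v-inv P≉0 (v-π^ k)))) (≡.cong fin (2k-2k≡0 k))
      where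
      2k-2k≡0 : ∀ k → (k ℤ.+ k) ℤ.+ (ℤ.- k ℤ.+ ℤ.- k) ≡ 0ℤ
      2k-2k≡0 = solve-∀
    x≈wP² : x ≈ w * (P * P)
    x≈wP² = sym (trans (solve 3 (λ x i P → (x :* (i :* i)) :* (P :* P) := x :* ((P :* i) :* (P :* i))) refl x P⁻¹ P)
                (trans (*-congˡ (*-cong (*-inv P P≉0) (*-inv P P≉0))) (trans (*-congˡ (*-identityˡ 1#)) (*-identityʳ x))))

  odd-class : ∀ {d} → OddVal K d → ∃ λ f → d ~ π * power ε f
  odd-class {d} (m , v-d) =
    f , ~-trans d~dππ (~-trans (~-* dπ~εᶠ (~-refl π≉0)) (~-reflexive (*-comm _ _) (*-≉0 π≉0 (power-ε≉0 f))))
    where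
    1+2m+1≡[1+m]+[1+m] : ∀ m → (1ℤ ℤ.+ + 2 ℤ.* m) ℤ.+ 1ℤ ≡ (1ℤ ℤ.+ m) ℤ.+ (1ℤ ℤ.+ m)
    1+2m+1≡[1+m]+[1+m] = solve-∀
    d≉0 = v≡fin⇒≉0 v-d
    v-dπ : v (d * π) ≡ fin ((1ℤ ℤ.+ m) ℤ.+ (1ℤ ℤ.+ m))
    v-dπ = ≡.trans (v-* v-d v-π) (≡.cong fin (1+2m+1≡[1+m]+[1+m] m))
    class = even-class {k = 1ℤ ℤ.+ m} v-dπ
    f = proj₁ class
    dπ~εᶠ : d * π ~ power ε f
    dπ~εᶠ = proj₂ class
    d~dππ : d ~ d * π * π
    d~dππ = ~-sym (~-square-multiple π≉0 (*-assoc d π π) d≉0)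

  square-class : ∀ {x} → x ≉ 0# → ∃₂ λ e f → x ~ power π e * power ε f
  square-class {x} x≉0 with ≉0⇒v≡fin x≉0
  ... | k , v-x with even-or-odd k
  ...   | inj₁ (m , k≡m+m) = let f , x~εᶠ = even-class {k = m} (≡.trans v-x (≡.cong fin k≡m+m)) in
    F.zero , f , ~-trans x~εᶠ (~-reflexive (sym (*-identityˡ _)) (*-≉0 1≉0 (power-ε≉0 f)))
  ...   | inj₂ (m , k≡1+2m) = let f , x~πεᶠ = odd-class (m , ≡.trans v-x (≡.cong fin k≡1+2m)) in
    F.suc F.zero , f , x~πεᶠ

  ~-perturb : ∀ {x y k} → v x ≡ fin k → ℤ.suc k ≤ᵛ y → x ~ x + y
  ~-perturb {x} {y} {k} v-x y-small = x≉0 , v≡fin⇒≉0 (v-+-strict v-x y-small) ,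
    square-≈ (sym x[x+y]≈x²[1+t]) (square-* (square-x² x) (hensel 1+t-unit 1+t≡1²))
    where
    x≉0 = v≡fin⇒≉0 v-x
    t = y * inv x x≉0
    t∈𝔪 : 1ℤ ≤ᵛ t
    t∈𝔪 = ≤ᵛ-weaken (ℤP.≤-reflexive (≡.sym (1+k-k≡1 k))) (≤ᵛ-* y-small (≤ᵛ-refl (v-inv x≉0 v-x)))
      where
      1+k-k≡1 : ∀ k → (1ℤ ℤ.+ k) ℤ.+ ℤ.- k ≡ 1ℤ
      1+k-k≡1 = solve-∀
    1+t-unit : Unit K (1# + t)
    1+t-unit = v-+-strict v-1 t∈𝔪
    1+t≡1² : 1# + t ≡𝔪 1# * 1#
    1+t≡1² = ≤ᵛ-cong (solve 1 (λ t → t := (con (+ 1) :+ t) :- con (+ 1) :* con (+ 1)) refl t) t∈𝔪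
    x[x+y]≈x²[1+t] : x * (x + y) ≈ (x * x) * (1# + t)
    x[x+y]≈x²[1+t] = sym (begin
      (x * x) * (1# + y * inv x x≉0)        ≈⟨ solve 3 (λ x y i → (x :* x) :* (con (+ 1) :+ y :* i) := x :* (x :+ y :* (x :* i)))
                                                     refl x y (inv x x≉0) ⟩
      x * (x + y * (x * inv x x≉0))         ≈⟨ *-congˡ (+-congˡ (*-congˡ (*-inv x x≉0))) ⟩
      x * (x + y * 1#)                      ≈⟨ *-congˡ (+-congˡ (*-identityʳ y)) ⟩
      x * (x + y)                           ∎)
      where open import Relation.Binary.Reasoning.Setoid setoid

  -1-square : IsSquare K (- 1#)
  -1-square = 𝔽.-1-square (q / 4) ≡.refl

  invSquareModV⇒square : ∀ {x} → InvSquareModV K x → IsSquare K x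
  invSquareModV⇒square (x-unit , _ , _ , x≡z²) = hensel x-unit x≡z²

  neg-square : ∀ {x} → IsSquare K x → IsSquare K (- x)
  neg-square {x} x-square = square-≈ (solve 1 (λ x → (:- con (+ 1)) :* x := :- x) refl x) (square-* -1-square x-square)

  ε+1-unit : Unit K (ε + 1#)
  ε+1-unit with 1ℤ ≤ᵛ? ε + 1#
  ... | no  ε+1∉𝔪 = integral∧¬𝔪⇒unit (≤ᵛ-+ (≤ᵛ-refl ε-unit) (≤ᵛ-refl v-1)) ε+1∉𝔪
  ... | yes ε+1∈𝔪 = ⊥-elim (ε-nonsquare (hensel ε-unit ε≡i²))
    where
    i = proj₁ -1-square
    ε≡i² : ε ≡𝔪 i * i
    ε≡i² = ≤ᵛ-cong (+-congˡ (-‿cong (proj₂ -1-square)))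
                   (≤ᵛ-cong (solve 1 (λ e → e :+ con (+ 1) := e :- (:- con (+ 1))) refl ε) ε+1∈𝔪)

  ε⁻¹ : Carrier
  ε⁻¹ = inv ε ε≉0

  ε⁻¹-unit : Unit K ε⁻¹
  ε⁻¹-unit = v-inv ε≉0 ε-unit

  ε⁻¹~ε : ε⁻¹ ~ ε
  ε⁻¹~ε = unit⇒≉0 ε⁻¹-unit , ε≉0 , square-≈ (sym (trans (*-comm _ _) (*-inv ε ε≉0))) square-1

  ε⁻¹+1≈ε⁻¹[ε+1] : ε⁻¹ + 1# ≈ ε⁻¹ * (ε + 1#)
  ε⁻¹+1≈ε⁻¹[ε+1] = sym (trans (solve 2 (λ e i → i :* (e :+ con (+ 1)) := e :* i :+ i) refl ε ε⁻¹)
                              (trans (+-congʳ (*-inv ε ε≉0)) (+-comm 1# ε⁻¹)))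

  ε⁻¹+1-unit : Unit K (ε⁻¹ + 1#)
  ε⁻¹+1-unit = ≡.trans (v-cong ε⁻¹+1≈ε⁻¹[ε+1]) (v-* ε⁻¹-unit ε+1-unit)

  ε⁻¹-nonsquare : ¬ IsSquare K ε⁻¹
  ε⁻¹-nonsquare ε⁻¹-square =
    ε-nonsquare (~1⇒square (~-trans (~-sym ε⁻¹~ε) (square⇒~1 (unit⇒≉0 ε⁻¹-unit) ε⁻¹-square)))

  record NonsquareFollowedBy (P : Carrier → Set (c ⊔ ℓ)) : Set (c ⊔ ℓ) where
    field
      m        : Carrier
      m-unit   : Unit K m
      m~ε      : m ~ ε
      m+1-unit : Unit K (m + 1#)
      property : P m

  nonsquare-followed-by-square : NonsquareFollowedBy λ m → IsSquare K (m + 1#)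
  nonsquare-followed-by-square with isSquare? ε+1-unit
  ... | yes ε+1-square    = record
    { m = ε ; m-unit = ε-unit ; m~ε = ~-refl ε≉0 ; m+1-unit = ε+1-unit ; property = ε+1-square }
  ... | no  ε+1-nonsquare = record
    { m = ε⁻¹ ; m-unit = ε⁻¹-unit ; m~ε = ε⁻¹~ε ; m+1-unit = ε⁻¹+1-unit
    ; property = square-≈ (sym ε⁻¹+1≈ε⁻¹[ε+1]) (nonsquare-units-product ε⁻¹-unit ε+1-unit ε⁻¹-nonsquare ε+1-nonsquare)
    }

  nonsquare-followed-by-nonsquare : NonsquareFollowedBy λ m → IsSquare K (m * (m + 1#))
  nonsquare-followed-by-nonsquare with isSquare? ε+1-unit
  ... | yes ε+1-square    = record
    { m = ε⁻¹ ; m-unit = ε⁻¹-unit ; m~ε = ε⁻¹~ε ; m+1-unit = ε⁻¹+1-unit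
    ; property = square-≈ (trans (*-assoc _ _ _) (*-congˡ (sym ε⁻¹+1≈ε⁻¹[ε+1]))) (square-* (square-x² ε⁻¹) ε+1-square)
    }
  ... | no  ε+1-nonsquare = record
    { m = ε ; m-unit = ε-unit ; m~ε = ~-refl ε≉0 ; m+1-unit = ε+1-unit
    ; property = nonsquare-units-product ε-unit ε+1-unit ε-nonsquare ε+1-nonsquare
    }

module KummerImage {c ℓ} (K : NALocalField c ℓ) (q≡1[4] : NALocalField.q K % 4 ≡ 1)
             (π ε : NALocalField.Carrier K) (v-π : NALocalField.v K π ≡ fin 1ℤ)
             (ε-unit : Unit K ε) (ε-nonsquare : ¬ IsSquare K ε)
             (a₁ a₂ a₃ : NALocalField.Carrier K) where
  open NALocalField K
  open Valuation K
  open Squares K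
  open ResidueField K (q / 4 ℕ.* 2) (q≡1[4]⇒odd q≡1[4]) using (hensel)
  open SquareClasses K q≡1[4] π ε v-π ε-unit ε-nonsquare
  open Curve K a₁ a₂ a₃
  open ℤ-Coefficients cring

  select : Bool → Carrier → Carrier
  select true  x = x
  select false x = 1#

  embed : Bool → Bool → Carrier → Pair K
  embed b₁ b₂ x = select b₁ x , select b₂ x

  select-~ : ∀ b {x y} → x ~ y → select b x ~ select b y
  select-~ true  x~y = x~y
  select-~ false _   = ~-refl 1≉0

  embed-~ : ∀ b₁ b₂ {x y} → x ~ y → embed b₁ b₂ x ∼² embed b₁ b₂ y
  embed-~ b₁ b₂ x~y = select-~ b₁ x~y , select-~ b₂ x~y

  select-span : ∀ b e f → select b (power π e * power ε f) ~ power (select b π) e * power (select b ε) f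
  select-span true  e f = ~-refl (*-≉0 (power-π≉0 e) (power-ε≉0 f))
  select-span false e f = ~-reflexive (sym (trans (*-cong (power-1 e) (power-1 f)) (*-identityˡ 1#))) (*-≉0 (power-1≉0 e) (power-1≉0 f))
    where
    power-1 : ∀ e → power 1# e ≈ 1#
    power-1 F.zero    = refl
    power-1 (F.suc _) = refl
    power-1≉0 : ∀ e → power 1# e ≉ 0#
    power-1≉0 e p = 1≉0 (trans (sym (power-1 e)) p)

  pow-embed : ∀ b₁ b₂ x e → pow K (embed b₁ b₂ x) e ≡ (power (select b₁ x) e , power (select b₂ x) e)
  pow-embed b₁ b₂ x F.zero    = ≡.refl
  pow-embed b₁ b₂ x (F.suc _) = ≡.refl

  embed-span : ∀ b₁ b₂ e f →
               embed b₁ b₂ (power π e * power ε f) ∼² _⊙_ K (pow K (embed b₁ b₂ π) e) (pow K (embed b₁ b₂ ε) f)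
  embed-span b₁ b₂ e f rewrite pow-embed b₁ b₂ π e | pow-embed b₁ b₂ ε f = select-span b₁ e f , select-span b₂ e f

  Embeds : Bool → Bool → Pair K → Set (c ⊔ ℓ)
  Embeds b₁ b₂ p = ∃ λ x → x ≉ 0# × p ∼² embed b₁ b₂ x

  -- r, r′ are the two roots at odd distance and f the far root; embed b₁ b₂ places the
  -- class of x − r in the coordinates of the Kummer pair (x − a₁, x − a₂) that it occupies.
  record Configuration : Set (c ⊔ ℓ) where
    field
      r r′ f        : Carrier
      b₁ b₂         : Bool
      r-integral    : Integral K r
      r′-integral   : Integral K r′
      near-odd      : OddVal K (r - r′)
      far-unit      : Unit K (r - f)
      far-square    : IsSquare K (r - f)
      factorisation : ∀ x → (x - a₁) * (x - a₂) * (x - a₃) ≈ (x - r) * (x - r′) * (x - f)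
      δ-generic-class : ∀ {x} → x ≉ a₁ → x ≉ a₂ → IsSquare K ((x - r) * (x - r′)) → IsSquare K (x - f) →
                        x - r ≉ 0# × (x - a₁ , x - a₂) ∼² embed b₁ b₂ (x - r)
      δ-P₁-embeds   : Embeds b₁ b₂ (α * β , α)
      δ-P₂-embeds   : Embeds b₁ b₂ (- α , - α * γ)
      root-point    : Σ Point λ P → Σ (Pair K) λ p → δ P p × p ∼² embed b₁ b₂ (r - r′)

  module Configured (C : Configuration) where
    open Configuration C

    d : Carrier
    d = r - r′

    d≉0 : d ≉ 0#
    d≉0 = v≡fin⇒≉0 (proj₂ near-odd)

    d∈𝔪 : 1ℤ ≤ᵛ d
    d∈𝔪 = odd⇒∈𝔪 (≤ᵛ-- r-integral r′-integral) near-odd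

    x-r+d≈x-r′ : ∀ x → (x - r) + d ≈ x - r′
    x-r+d≈x-r′ x = solve 3 (λ x r r′ → (x :- r) :+ (r :- r′) := x :- r′) refl x r r′

    far-factor : ∀ {x} → 1ℤ ≤ᵛ x - r → Unit K (x - f) × IsSquare K (x - f)
    far-factor {x} x≡r = x-f-unit , hensel x-f-unit (≡𝔪-trans x-f≡r-f (≡𝔪-reflexive (proj₂ far-square)))
      where
      x-f≡r-f : x - f ≡𝔪 r - f
      x-f≡r-f = ≤ᵛ-cong (solve 3 (λ x r f → x :- r := (x :- f) :- (r :- f)) refl x r f) x≡r
      x-f-unit : Unit K (x - f)
      x-f-unit = unit-≡𝔪 far-unit x-f≡r-f

    near-factors : ∀ {x} → ¬ (1ℤ ≤ᵛ x - r) → x - r ~ x - r′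
    near-factors {x} x≢r with ≉0⇒v≡fin (λ x-r≈0 → x≢r (≤ᵛ-cong (sym x-r≈0) (≤ᵛ-0 1ℤ)))
    ... | k , v-x-r = ~-trans (~-perturb v-x-r (≤ᵛ-weaken k+1≤1 d∈𝔪)) (~-reflexive (x-r+d≈x-r′ x) x-r′≉0)
      where
      k+1≤1 : ℤ.suc k ℤ.≤ 1ℤ
      k+1≤1 = ℤP.i<j⇒suc[i]≤j (ℤP.≰⇒> λ 1≤k → x≢r (≡.subst (fin 1ℤ ≤∞_) (≡.sym v-x-r) (fin≤fin 1≤k)))
      x-r′≉0 : x - r′ ≉ 0#
      x-r′≉0 = v≡fin⇒≉0 (≡.trans (v-cong (sym (x-r+d≈x-r′ x))) (v-+-strict v-x-r (≤ᵛ-weaken k+1≤1 d∈𝔪)))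

    curve-squares : ∀ {x y} → y * y ≈ (x - r) * (x - r′) * (x - f) →
                    IsSquare K ((x - r) * (x - r′)) × IsSquare K (x - f)
    curve-squares {x} {y} eq with 1ℤ ≤ᵛ? x - r
    ... | yes x≡r = square-cancelˡ (unit⇒≉0 x-f-unit) x-f-square (square-≈ (trans eq (*-comm _ _)) (square-x² y)) , x-f-square
      where
      x-f-unit = proj₁ (far-factor x≡r)
      x-f-square = proj₂ (far-factor x≡r)
    ... | no  x≢r = near , square-cancelˡ (*-≉0 x-r≉0 x-r′≉0) near (square-≈ eq (square-x² y))
      where
      x-r≉0 = proj₁ (near-factors x≢r)
      x-r′≉0 = proj₁ (proj₂ (near-factors x≢r))
      near = proj₂ (proj₂ (near-factors x≢r))

    Realizes : Carrier → Set (c ⊔ ℓ)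
    Realizes x = Σ Point λ P → Σ (Pair K) λ p → δ P p × p ∼² embed b₁ b₂ x

    realizes-~ : ∀ {x x′} → x ~ x′ → Realizes x → Realizes x′
    realizes-~ x~x′ (P , p , δPp , p∼x) = P , p , δPp , ∼²-trans p∼x (embed-~ b₁ b₂ x~x′)

    realizes-point : ∀ x → x - r ≉ 0# → x - r′ ≉ 0# → x - f ≉ 0# →
                     IsSquare K ((x - r) * (x - r′)) → IsSquare K (x - f) → Realizes (x - r)
    realizes-point x x-r≉0 x-r′≉0 x-f≉0 (s , near≈s²) (t , far≈t²) =
      affine x (s * t) on-curve , (x - a₁ , x - a₂) , δ-generic x (s * t) on-curve x≉a₁ x≉a₂ ,
      proj₂ (δ-generic-class x≉a₁ x≉a₂ (s , near≈s²) (t , far≈t²))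
      where
      on-curve : (s * t) * (s * t) ≈ (x - a₁) * (x - a₂) * (x - a₃)
      on-curve = trans (solve 2 (λ s t → (s :* t) :* (s :* t) := (s :* s) :* (t :* t)) refl s t)
                       (trans (sym (*-cong near≈s² far≈t²)) (sym (factorisation x)))
      product≉0 : (x - a₁) * (x - a₂) * (x - a₃) ≉ 0#
      product≉0 p≈0 = *-≉0 (*-≉0 x-r≉0 x-r′≉0) x-f≉0 (trans (sym (factorisation x)) p≈0)
      x≉a₁ : x ≉ a₁
      x≉a₁ x≈a₁ = product≉0 (trans (*-congʳ (trans (*-congʳ (x≈y⇒x-y≈0 x≈a₁)) (zeroˡ _))) (zeroˡ _))
      x≉a₂ : x ≉ a₂
      x≉a₂ x≈a₂ = product≉0 (trans (*-congʳ (trans (*-congˡ (x≈y⇒x-y≈0 x≈a₂)) (zeroʳ _))) (zeroˡ _))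

    realizes-ε : Realizes ε
    realizes-ε = realizes-~ (~-trans (~-reflexive x-r≈t t≉0) t~ε)
      (realizes-point x (λ p → t≉0 (trans (sym x-r≈t) p)) x-r′≉0 x-f≉0 near-square far-square′)
      where
      open NonsquareFollowedBy nonsquare-followed-by-square renaming (property to m+1-square)
      t = (r - f) * m
      t-unit : Unit K t
      t-unit = v-* far-unit m-unit
      t≉0 = unit⇒≉0 t-unit
      t~ε : t ~ ε
      t~ε = ~-trans (square-*-~ (unit⇒≉0 far-unit) far-square (unit⇒≉0 m-unit)) m~ε
      x = r + t
      x-r≈t : x - r ≈ t
      x-r≈t = solve 2 (λ r t → (r :+ t) :- r := t) refl r t
      x-r′≉0 : x - r′ ≉ 0#
      x-r′≉0 = v≡fin⇒≉0 (≡.trans (v-cong (trans (sym (x-r+d≈x-r′ x)) (+-congʳ x-r≈t))) (v-+-strict t-unit d∈𝔪))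
      near-square : IsSquare K ((x - r) * (x - r′))
      near-square = square-≈ (*-cong (sym x-r≈t) (trans (+-congʳ (sym x-r≈t)) (x-r+d≈x-r′ x)))
                             (proj₂ (proj₂ (~-perturb t-unit d∈𝔪)))
      x-f≈[r-f][m+1] : x - f ≈ (r - f) * (m + 1#)
      x-f≈[r-f][m+1] = solve 3 (λ r f m → (r :+ (r :- f) :* m) :- f := (r :- f) :* (m :+ con (+ 1))) refl r f m
      x-f≉0 : x - f ≉ 0#
      x-f≉0 = v≡fin⇒≉0 (≡.trans (v-cong x-f≈[r-f][m+1]) (v-* far-unit m+1-unit))
      far-square′ : IsSquare K (x - f)
      far-square′ = square-≈ (sym x-f≈[r-f][m+1]) (square-* far-square m+1-square)

    realizes-dε : Realizes (d * ε)
    realizes-dε = realizes-~ (~-trans (~-reflexive x-r≈t t≉0) (~-* (~-refl d≉0) m~ε))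
      (realizes-point x (λ p → t≉0 (trans (sym x-r≈t) p)) x-r′≉0 (unit⇒≉0 (proj₁ far)) near-square (proj₂ far))
      where
      open NonsquareFollowedBy nonsquare-followed-by-nonsquare renaming (property to m[m+1]-square)
      t = d * m
      t≉0 = *-≉0 d≉0 (unit⇒≉0 m-unit)
      x = r + t
      x-r≈t : x - r ≈ t
      x-r≈t = solve 2 (λ r t → (r :+ t) :- r := t) refl r t
      x-r′≈d[m+1] : x - r′ ≈ d * (m + 1#)
      x-r′≈d[m+1] = solve 3 (λ r r′ m → (r :+ (r :- r′) :* m) :- r′ := (r :- r′) :* (m :+ con (+ 1))) refl r r′ m
      x-r′≉0 : x - r′ ≉ 0#
      x-r′≉0 p = *-≉0 d≉0 (unit⇒≉0 m+1-unit) (trans (sym x-r′≈d[m+1]) p)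
      near-square : IsSquare K ((x - r) * (x - r′))
      near-square = square-≈ (trans (solve 2 (λ d m → (d :* d) :* (m :* (m :+ con (+ 1)))
                                                     := (d :* m) :* (d :* (m :+ con (+ 1)))) refl d m)
                                    (sym (*-cong x-r≈t x-r′≈d[m+1])))
                             (square-* (square-x² d) m[m+1]-square)
      far : Unit K (x - f) × IsSquare K (x - f)
      far = far-factor (≤ᵛ-cong (sym x-r≈t) (≤ᵛ-* d∈𝔪 (≤ᵛ-refl m-unit)))

    realizes-1 : Realizes 1#
    realizes-1 = O , (1# , 1#) , δ-O , select-1 b₁ , select-1 b₂
      where
      select-1 : ∀ b → 1# ~ select b 1#
      select-1 true  = ~-refl 1≉0
      select-1 false = ~-refl 1≉0

    realizes-πεᶠ : ∀ {f₀} → d ~ π * power ε f₀ → ∀ f → Realizes (π * power ε f)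
    realizes-πεᶠ {F.zero}  d~π  F.zero    = realizes-~ d~π root-point
    realizes-πεᶠ {F.suc _} d~πε (F.suc _) = realizes-~ d~πε root-point
    realizes-πεᶠ {F.zero}  d~π  (F.suc _) = realizes-~ (~-trans (~-* d~π (~-refl ε≉0)) (~-reflexive π1ε≈πε πε≉0)) realizes-dε
      where
      πε≉0 = *-≉0 π≉0 ε≉0
      π1ε≈πε : π * 1# * ε ≈ π * ε
      π1ε≈πε = *-congʳ (*-identityʳ π)
    realizes-πεᶠ {F.suc _} d~πε F.zero    = realizes-~ (~-trans (~-* d~πε (~-refl ε≉0)) πεε~π1) realizes-dε
      where
      πεε~π1 : π * ε * ε ~ π * 1#
      πεε~π1 = ~-trans (~-reflexive (solve 2 (λ π ε → π :* ε :* ε := (ε :* ε) :* π) refl π ε)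
                                    (*-≉0 (*-≉0 ε≉0 ε≉0) π≉0))
               (~-trans (square-*-~ (*-≉0 ε≉0 ε≉0) (square-x² ε) π≉0) (~-reflexive (sym (*-identityʳ π)) (*-≉0 π≉0 1≉0)))

    realizes-class : ∀ e f → Realizes (power π e * power ε f)
    realizes-class F.zero    F.zero    = realizes-~ (~-reflexive (sym (*-identityˡ 1#)) (*-≉0 1≉0 1≉0)) realizes-1
    realizes-class F.zero    (F.suc _) = realizes-~ (~-reflexive (sym (*-identityˡ ε)) (*-≉0 1≉0 ε≉0)) realizes-ε
    realizes-class (F.suc _) f         = realizes-πεᶠ {proj₁ (odd-class near-odd)} (proj₂ (odd-class near-odd)) f

    δ-embeds : ∀ P p → δ P p → Embeds b₁ b₂ p
    δ-embeds _ _ δ-O                         = 1# , 1≉0 , proj₂ (proj₂ (proj₂ realizes-1))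
    δ-embeds _ _ (δ-generic x y on-curve x≉a₁ x≉a₂) =
      let near-square , far-square = curve-squares (trans on-curve (factorisation x))
          x-r≉0 , class = δ-generic-class x≉a₁ x≉a₂ near-square far-square
      in x - r , x-r≉0 , class
    δ-embeds _ _ (δ-P₁ _ _ _ _)              = δ-P₁-embeds
    δ-embeds _ _ (δ-P₂ _ _ _ _)              = δ-P₂-embeds

    embeds⇒inSpan : ∀ {p} → Embeds b₁ b₂ p → InSpan K (embed b₁ b₂ π) (embed b₁ b₂ ε) p
    embeds⇒inSpan (x , x≉0 , p∼x) =
      let e , f , x~πᵉεᶠ = square-class x≉0
      in e , f , ∼²-trans p∼x (∼²-trans (embed-~ b₁ b₂ x~πᵉεᶠ) (embed-span b₁ b₂ e f))

    image : ImageIs (embed b₁ b₂ π) (embed b₁ b₂ ε)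
    image = (λ P p δPp → embeds⇒inSpan (δ-embeds P p δPp))
          , λ { p (e , f , p∼πᵉεᶠ) →
                let P , p′ , δPp′ , p′∼πᵉεᶠ = realizes-class e f
                in P , p′ , δPp′ , ∼²-trans p′∼πᵉεᶠ (∼²-trans (embed-span b₁ b₂ e f) (∼²-sym p∼πᵉεᶠ)) }

  root-a₁ : 0# * 0# ≈ (a₁ - a₁) * (a₁ - a₂) * (a₁ - a₃)
  root-a₁ = solve 3 (λ a b c → con (+ 0) :* con (+ 0) := (a :- a) :* (a :- b) :* (a :- c)) refl a₁ a₂ a₃

  root-a₂ : 0# * 0# ≈ (a₂ - a₁) * (a₂ - a₂) * (a₂ - a₃)
  root-a₂ = solve 3 (λ a b c → con (+ 0) :* con (+ 0) := (b :- a) :* (b :- b) :* (b :- c)) refl a₁ a₂ a₃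

  module Cases (a₁∈O : Integral K a₁) (a₂∈O : Integral K a₂) (a₃∈O : Integral K a₃) where

    configuration-α : OddVal K α × InvSquareModV K β × InvSquareModV K γ → Configuration
    configuration-α (α-odd , β-square-mod , γ-square-mod) = record
      { r = a₁ ; r′ = a₂ ; f = a₃ ; b₁ = true ; b₂ = true
      ; r-integral = a₁∈O ; r′-integral = a₂∈O ; near-odd = α-odd
      ; far-unit = proj₁ β-square-mod ; far-square = invSquareModV⇒square β-square-mod
      ; factorisation = λ _ → refl
      ; δ-generic-class = λ x≉a₁ x≉a₂ near _ →
          ≉⇒-≉0 x≉a₁ , ~-refl (≉⇒-≉0 x≉a₁) , (≉⇒-≉0 x≉a₂ , ≉⇒-≉0 x≉a₁ , square-≈ (*-comm _ _) near)
      ; δ-P₁-embeds = α , α≉0 , P₁-class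
      ; δ-P₂-embeds = - α , neg-≉0 α≉0 , ~-refl (neg-≉0 α≉0) ,
                      *-square-~ (neg-≉0 α≉0) (unit⇒≉0 (proj₁ γ-square-mod)) (invSquareModV⇒square γ-square-mod)
      ; root-point = affine a₁ 0# root-a₁ , (α * β , α) , δ-P₁ a₁ 0# root-a₁ refl , P₁-class
      }
      where
      α≉0 = v≡fin⇒≉0 (proj₂ α-odd)
      P₁-class : (α * β , α) ∼² (α , α)
      P₁-class = *-square-~ α≉0 (unit⇒≉0 (proj₁ β-square-mod)) (invSquareModV⇒square β-square-mod) , ~-refl α≉0

    configuration-β : OddVal K β × InvSquareModV K α × InvSquareModV K γ → Configuration
    configuration-β (β-odd , α-square-mod , γ-square-mod) = record
      { r = a₁ ; r′ = a₃ ; f = a₂ ; b₁ = true ; b₂ = false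
      ; r-integral = a₁∈O ; r′-integral = a₃∈O ; near-odd = β-odd
      ; far-unit = proj₁ α-square-mod ; far-square = α-square
      ; factorisation = λ x → solve 3 (λ A B C → A :* B :* C := A :* C :* B) refl (x - a₁) (x - a₂) (x - a₃)
      ; δ-generic-class = λ x≉a₁ x≉a₂ _ far → ≉⇒-≉0 x≉a₁ , ~-refl (≉⇒-≉0 x≉a₁) , square⇒~1 (≉⇒-≉0 x≉a₂) far
      ; δ-P₁-embeds = β , β≉0 , P₁-class
      ; δ-P₂-embeds = 1# , 1≉0 , square⇒~1 (neg-≉0 α≉0) (neg-square α-square) ,
                      square⇒~1 (*-≉0 (neg-≉0 α≉0) γ≉0) (square-* (neg-square α-square) (invSquareModV⇒square γ-square-mod))
      ; root-point = affine a₁ 0# root-a₁ , (α * β , α) , δ-P₁ a₁ 0# root-a₁ refl , P₁-class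
      }
      where
      α≉0 = unit⇒≉0 (proj₁ α-square-mod)
      β≉0 = v≡fin⇒≉0 (proj₂ β-odd)
      γ≉0 = unit⇒≉0 (proj₁ γ-square-mod)
      α-square = invSquareModV⇒square α-square-mod
      P₁-class : (α * β , α) ∼² (β , 1#)
      P₁-class = square-*-~ α≉0 α-square β≉0 , square⇒~1 α≉0 α-square

    configuration-γ : OddVal K γ × InvSquareModV K α × InvSquareModV K β → Configuration
    configuration-γ (γ-odd , α-square-mod , β-square-mod) = record
      { r = a₂ ; r′ = a₃ ; f = a₁ ; b₁ = false ; b₂ = true
      ; r-integral = a₂∈O ; r′-integral = a₃∈O ; near-odd = γ-odd
      ; far-unit = ≡.trans (v-cong a₂-a₁≈-α) (≡.trans (v-neg α) (proj₁ α-square-mod))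
      ; far-square = square-≈ (sym a₂-a₁≈-α) (neg-square α-square)
      ; factorisation = λ x → solve 3 (λ A B C → A :* B :* C := B :* C :* A) refl (x - a₁) (x - a₂) (x - a₃)
      ; δ-generic-class = λ x≉a₁ x≉a₂ _ far → ≉⇒-≉0 x≉a₂ , square⇒~1 (≉⇒-≉0 x≉a₁) far , ~-refl (≉⇒-≉0 x≉a₂)
      ; δ-P₁-embeds = 1# , 1≉0 , square⇒~1 (*-≉0 α≉0 β≉0) (square-* α-square (invSquareModV⇒square β-square-mod)) ,
                      square⇒~1 α≉0 α-square
      ; δ-P₂-embeds = γ , γ≉0 , P₂-class
      ; root-point = affine a₂ 0# root-a₂ , (- α , - α * γ) , δ-P₂ a₂ 0# root-a₂ refl , P₂-class
      }
      where
      α≉0 = unit⇒≉0 (proj₁ α-square-mod)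
      β≉0 = unit⇒≉0 (proj₁ β-square-mod)
      γ≉0 = v≡fin⇒≉0 (proj₂ γ-odd)
      α-square = invSquareModV⇒square α-square-mod
      a₂-a₁≈-α : a₂ - a₁ ≈ - α
      a₂-a₁≈-α = solve 2 (λ a b → b :- a := :- (a :- b)) refl a₁ a₂
      P₂-class : (- α , - α * γ) ∼² (1# , γ)
      P₂-class = square⇒~1 (neg-≉0 α≉0) (neg-square α-square) , square-*-~ (neg-≉0 α≉0) (neg-square α-square) γ≉0

lemma2p6 : ∀ {c ℓ} (K : NALocalField c ℓ) →
    let open NALocalField K in
    let open Curve K in
    NALocalField.q K % 4 ≡ 1 →
    (π ε a₁ a₂ a₃ : Carrier) →
    v π ≡ fin 1ℤ →
    Unit K ε → ¬ IsSquare K ε →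
    Integral K a₁ → Integral K a₂ → Integral K a₃ →
    ((OddVal K (α a₁ a₂ a₃) × InvSquareModV K (β a₁ a₂ a₃) × InvSquareModV K (γ a₁ a₂ a₃) →
        ImageIs a₁ a₂ a₃ (π , π) (ε , ε))
     × (OddVal K (β a₁ a₂ a₃) × InvSquareModV K (α a₁ a₂ a₃) × InvSquareModV K (γ a₁ a₂ a₃) →
        ImageIs a₁ a₂ a₃ (π , 1#) (ε , 1#))
     × (OddVal K (γ a₁ a₂ a₃) × InvSquareModV K (α a₁ a₂ a₃) × InvSquareModV K (β a₁ a₂ a₃) →
        ImageIs a₁ a₂ a₃ (1# , π) (1# , ε)))
lemma2p6 K q≡1[4] π ε a₁ a₂ a₃ v-π ε-unit ε-nonsquare a₁∈O a₂∈O a₃∈O =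
  Configured.image ∘ configuration-α , Configured.image ∘ configuration-β , Configured.image ∘ configuration-γ
  where
  open KummerImage K q≡1[4] π ε v-π ε-unit ε-nonsquare a₁ a₂ a₃
  open Cases a₁∈O a₂∈O a₃∈O
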